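{- Let $G$ be a simple undirected graph with $n\ge 0$ vertices of degrees $k_1,\dots,k_n$ and $m\ge 0$ edges, and write $n\langle k^2\rangle=\sum_{i=1}^n k_i^2$. Under a uniformly random linear arrangement of the vertices, the variance of the sum of edge lengths $D$ is $$\mathbb{V}_{rla}[D]=\frac{n+1}{45}\left[m\bigl(2(n-1)-m\bigr)+\left(\frac n4-1\right)n\langle k^2\rangle\right].$$
   Context: A linear arrangement of the vertex set $V$ ($|V|=n$) is a bijection $\pi:V\to\{1,\dots,n\}$; the length of an edge $\{u,v\}$ is $|\pi(u)-\pi(v)|$; $D$ is the sum of the lengths of all edges. In a uniformly random linear arrangement $\pi$ is uniform over all $n!$ bijections; $\mathbb{V}_{rla}[D]=\mathbb{E}_{rla}[D^2]-\mathbb{E}_{rla}[D]^2$ is the variance with respect to this choice. $\langle k^2\rangle=\frac1n\sum_i k_i^2$; the product $n\langle k^2\rangle$ is interpreted as $\sum_i k_i^2$. -}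

module Defs where

open import Data.Bool using (Bool; false; _∧_)
import Data.Nat.ListAction
open import Data.Nat as ℕ using (ℕ; zero; suc; ∣_-_∣; _<ᵇ_)
open import Data.Fin using (Fin; toℕ)
open import Data.Vec using (Vec; []; _∷_; lookup)
open import Data.List as List using (List; []; _∷_; allFin; concatMap; filterᵇ; length)
open import Data.Product using (_×_; _,_; proj₁; proj₂)
open import Data.Integer using (+_)
open import Data.Rational as ℚ using (ℚ; _/_)
open import Relation.Nullary.Decidable using (Dec; does; _→-dec_)
open import Relation.Binary.PropositionalEquality using (_≡_)
open import Data.Fin.Properties using (all?) renaming (_≟_ to _≟ᶠ_)

record SimpleGraph (n : ℕ) : Set where
  field
    adj    : Fin n → Fin n → Bool
    sym    : ∀ i j → adj i j ≡ adj j i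
    irrefl : ∀ i → adj i i ≡ false
open SimpleGraph public

sumℕ : List ℕ → ℕ
sumℕ = Data.Nat.ListAction.sum

-- edge set: unordered pairs {i,j} represented once as (i , j) with i < j
edges : ∀ {n} → SimpleGraph n → List (Fin n × Fin n)
edges {n} G =
  filterᵇ (λ p → (toℕ (proj₁ p) <ᵇ toℕ (proj₂ p)) ∧ adj G (proj₁ p) (proj₂ p))
          (concatMap (λ i → List.map (i ,_) (allFin n)) (allFin n))

numEdges : ∀ {n} → SimpleGraph n → ℕ
numEdges G = length (edges G)

degree : ∀ {n} → SimpleGraph n → Fin n → ℕ
degree {n} G i = length (filterᵇ (adj G i) (allFin n))

sumSqDeg : ∀ {n} → SimpleGraph n → ℕ
sumSqDeg {n} G = sumℕ (List.map (λ i → degree G i ℕ.* degree G i) (allFin n))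

allVecs : (n k : ℕ) → List (Vec (Fin n) k)
allVecs n zero    = [] ∷ []
allVecs n (suc k) = concatMap (λ v → List.map (_∷ v) (allFin n)) (allVecs n k)

injective? : ∀ {n} (v : Vec (Fin n) n) →
             Dec (∀ i j → lookup v i ≡ lookup v j → i ≡ j)
injective? v = all? λ i → all? λ j → (lookup v i ≟ᶠ lookup v j) →-dec (i ≟ᶠ j)

-- all linear arrangements: bijections π : V → {1..n}, vertex i placed at
-- position 1 + toℕ (lookup π i)
arrangements : (n : ℕ) → List (Vec (Fin n) n)
arrangements n = filterᵇ (λ v → does (injective? v)) (allVecs n n)

position : ∀ {n} → Vec (Fin n) n → Fin n → ℕ
position π i = suc (toℕ (lookup π i))

D : ∀ {n} → SimpleGraph n → Vec (Fin n) n → ℕ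
D G π = sumℕ (List.map (λ e → ∣ position π (proj₁ e) - position π (proj₂ e) ∣) (edges G))

mean : List ℚ → ℚ
mean []         = ℚ.0ℚ
mean (x ∷ xs)   = List.foldr ℚ._+_ ℚ.0ℚ (x ∷ xs) ℚ.* ((+ 1) / suc (length xs))

ℕtoℚ : ℕ → ℚ
ℕtoℚ k = (+ k) / 1

Erla : ∀ {n} → (Vec (Fin n) n → ℚ) → ℚ
Erla {n} f = mean (List.map f (arrangements n))

Vrla-D : ∀ {n} → SimpleGraph n → ℚ
Vrla-D G = Erla (λ π → ℕtoℚ (D G π) ℚ.* ℕtoℚ (D G π))
           ℚ.- (Erla (λ π → ℕtoℚ (D G π)) ℚ.* Erla (λ π → ℕtoℚ (D G π)))

module Submission where

-- With ℓ_ij the distance between the positions of i and j and a the adjacency matrix,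
-- 2 D = Σ a_ij ℓ_ij and 4 D² = Σ a_ij a_kl ℓ_ij ℓ_kl.  The positions of r distinct vertices form
-- a uniformly random injective r-tuple (each tuple is taken by (n − r)! arrangements), so
-- E ℓ_ij ℓ_kl depends only on how many endpoints the two edges share, and is obtained from the
-- power sums Σ|a−b|, Σ|a−b|², Σ_a (Σ_b |a−b|)² by inclusion–exclusion over coinciding positions.
-- Over all pairs of edges the coincidences of endpoints add up to 4 Σ k_i² and the double
-- coincidences to 4m, giving E D² in terms of n, m and Σ k_i²; with E D = m (n + 1) / 3 the
-- variance follows by a polynomial identity over ℚ.

module FiniteSums where

  open import Defs using (sumℕ)
  open import Data.Nat.ListAction.Properties using (sum-++)
  open import Data.Bool using (Bool; true; false)
  open import Data.Nat using (ℕ; zero; suc; _+_; _*_)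
  open import Data.Nat.Properties
  open import Data.Nat.Tactic.RingSolver using (solve-∀)
  open import Data.Fin as Fin using (Fin)
  open import Data.List as List using (List; []; _∷_; _++_; allFin; concatMap; filterᵇ; length)
  import Data.List.Properties as List
  open import Relation.Nullary using (does; yes; ¬_)
  open import Relation.Nullary.Decidable using (dec-true; dec-false; does-≡; map′)
  open import Relation.Binary.PropositionalEquality
  open ≡-Reasoning

  ∑ : {A : Set} → List A → (A → ℕ) → ℕ
  ∑ xs f = sumℕ (List.map f xs)

  𝟙 : Bool → ℕ
  𝟙 true  = 1
  𝟙 false = 0

  module _ {A : Set} where

    ∑-cong : (xs : List A) {f g : A → ℕ} → (∀ x → f x ≡ g x) → ∑ xs f ≡ ∑ xs g
    ∑-cong []       f≗g = refl
    ∑-cong (x ∷ xs) f≗g = cong₂ _+_ (f≗g x) (∑-cong xs f≗g)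

    ∑-++ : (xs ys : List A) (f : A → ℕ) → ∑ (xs ++ ys) f ≡ ∑ xs f + ∑ ys f
    ∑-++ xs ys f = trans (cong sumℕ (List.map-++ f xs ys)) (sum-++ (List.map f xs) (List.map f ys))

    ∑-filterᵇ : (p : A → Bool) (xs : List A) (f : A → ℕ) →
                ∑ (filterᵇ p xs) f ≡ ∑ xs (λ x → 𝟙 (p x) * f x)
    ∑-filterᵇ p []       f = refl
    ∑-filterᵇ p (x ∷ xs) f with p x
    ... | true  = cong₂ _+_ (sym (+-identityʳ (f x))) (∑-filterᵇ p xs f)
    ... | false = ∑-filterᵇ p xs f

    ∑-distrib-+ : (xs : List A) (f g : A → ℕ) → ∑ xs (λ x → f x + g x) ≡ ∑ xs f + ∑ xs g
    ∑-distrib-+ []       f g = refl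
    ∑-distrib-+ (x ∷ xs) f g = trans (cong (f x + g x +_) (∑-distrib-+ xs f g))
                                     (interchange (f x) (g x) (∑ xs f) (∑ xs g))
      where
      interchange : ∀ a b c d → a + b + (c + d) ≡ a + c + (b + d)
      interchange = solve-∀

    ∑-*ˡ : (xs : List A) (c : ℕ) (f : A → ℕ) → ∑ xs (λ x → c * f x) ≡ c * ∑ xs f
    ∑-*ˡ []       c f = sym (*-zeroʳ c)
    ∑-*ˡ (x ∷ xs) c f = trans (cong (c * f x +_) (∑-*ˡ xs c f)) (sym (*-distribˡ-+ c (f x) (∑ xs f)))

    ∑-*ʳ : (xs : List A) (c : ℕ) (f : A → ℕ) → ∑ xs (λ x → f x * c) ≡ ∑ xs f * c
    ∑-*ʳ xs c f = trans (∑-cong xs (λ x → *-comm (f x) c)) (trans (∑-*ˡ xs c f) (*-comm c _))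

    ∑-zero : (xs : List A) → ∑ xs (λ _ → 0) ≡ 0
    ∑-zero []       = refl
    ∑-zero (x ∷ xs) = ∑-zero xs

    ∑-one : (xs : List A) → ∑ xs (λ _ → 1) ≡ length xs
    ∑-one []       = refl
    ∑-one (x ∷ xs) = cong suc (∑-one xs)

  module _ {A B : Set} where

    ∑-map : (h : A → B) (xs : List A) (f : B → ℕ) → ∑ (List.map h xs) f ≡ ∑ xs (λ x → f (h x))
    ∑-map h xs f = cong sumℕ (sym (List.map-∘ xs))

    ∑-concatMap : (g : A → List B) (xs : List A) (f : B → ℕ) →
                  ∑ (concatMap g xs) f ≡ ∑ xs (λ x → ∑ (g x) f)
    ∑-concatMap g []       f = refl
    ∑-concatMap g (x ∷ xs) f = trans (∑-++ (g x) (concatMap g xs) f)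
                                     (cong (∑ (g x) f +_) (∑-concatMap g xs f))

    ∑-comm : (xs : List A) (ys : List B) (f : A → B → ℕ) →
             ∑ xs (λ x → ∑ ys (f x)) ≡ ∑ ys (λ y → ∑ xs (λ x → f x y))
    ∑-comm []       ys f = sym (∑-zero ys)
    ∑-comm (x ∷ xs) ys f = trans (cong (∑ ys (f x) +_) (∑-comm xs ys f))
                                 (sym (∑-distrib-+ ys (f x) (λ y → ∑ xs (λ x′ → f x′ y))))

  ∑-allFin-suc : ∀ n (f : Fin (suc n) → ℕ) →
                 ∑ (allFin (suc n)) f ≡ f Fin.zero + ∑ (allFin n) (λ x → f (Fin.suc x))
  ∑-allFin-suc n f = cong (f Fin.zero +_) (cong sumℕ
    (trans (List.map-tabulate Fin.suc f) (sym (List.map-tabulate (λ x → x) (λ x → f (Fin.suc x))))))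

  ∑-allFin-one : ∀ n → ∑ (allFin n) (λ _ → 1) ≡ n
  ∑-allFin-one n = trans (∑-one (allFin n)) (List.length-tabulate {n = n} (λ x → x))

  _==_ : ∀ {n} → Fin n → Fin n → Bool
  x == y = does (x Fin.≟ y)

  ==-refl : ∀ {n} (x : Fin n) → (x == x) ≡ true
  ==-refl x = dec-true (x Fin.≟ x) refl

  ==⇒≡ : ∀ {n} {x y : Fin n} → (x == y) ≡ true → x ≡ y
  ==⇒≡ {x = x} {y} eq with x Fin.≟ y
  ... | yes x≡y = x≡y

  ≢⇒==false : ∀ {n} {x y : Fin n} → ¬ x ≡ y → (x == y) ≡ false
  ≢⇒==false {x = x} {y} = dec-false (x Fin.≟ y)

  ==-sym : ∀ {n} (x y : Fin n) → (x == y) ≡ (y == x)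
  ==-sym x y = does-≡ (x Fin.≟ y) (map′ sym sym (y Fin.≟ x))

  ∑-δ : ∀ n (y : Fin n) (f : Fin n → ℕ) → ∑ (allFin n) (λ x → 𝟙 (x == y) * f x) ≡ f y
  ∑-δ (suc n) Fin.zero f = begin
    ∑ (allFin (suc n)) (λ x → 𝟙 (x == Fin.zero) * f x)
      ≡⟨ ∑-allFin-suc n (λ x → 𝟙 (x == Fin.zero) * f x) ⟩
    f Fin.zero + 0 + ∑ (allFin n) (λ _ → 0) ≡⟨ cong (f Fin.zero + 0 +_) (∑-zero (allFin n)) ⟩
    f Fin.zero + 0 + 0                      ≡⟨ trans (+-identityʳ _) (+-identityʳ _) ⟩
    f Fin.zero                              ∎
  ∑-δ (suc n) (Fin.suc y) f =
    trans (∑-allFin-suc n (λ x → 𝟙 (x == Fin.suc y) * f x)) (∑-δ n y (λ x → f (Fin.suc x)))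

  ∑-δˡ : ∀ n (y : Fin n) (f : Fin n → ℕ) → ∑ (allFin n) (λ x → 𝟙 (y == x) * f x) ≡ f y
  ∑-δˡ n y f = trans (∑-cong (allFin n) (λ x → cong (λ b → 𝟙 b * f x) (==-sym y x))) (∑-δ n y f)

  module _ {n : ℕ} where

    ∑² : (Fin n → Fin n → ℕ) → ℕ
    ∑² f = ∑ (allFin n) (λ a → ∑ (allFin n) (f a))

    ∑³ : (Fin n → Fin n → Fin n → ℕ) → ℕ
    ∑³ f = ∑ (allFin n) (λ a → ∑² (f a))

    ∑⁴ : (Fin n → Fin n → Fin n → Fin n → ℕ) → ℕ
    ∑⁴ f = ∑ (allFin n) (λ a → ∑³ (f a))

    ∑²-cong : ∀ {f g : Fin n → Fin n → ℕ} → (∀ a b → f a b ≡ g a b) → ∑² f ≡ ∑² g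
    ∑²-cong f≗g = ∑-cong (allFin n) (λ a → ∑-cong (allFin n) (f≗g a))

    ∑³-cong : ∀ {f g : Fin n → Fin n → Fin n → ℕ} → (∀ a b c → f a b c ≡ g a b c) → ∑³ f ≡ ∑³ g
    ∑³-cong f≗g = ∑-cong (allFin n) (λ a → ∑²-cong (f≗g a))

    ∑⁴-cong : ∀ {f g : Fin n → Fin n → Fin n → Fin n → ℕ} → (∀ a b c d → f a b c d ≡ g a b c d) → ∑⁴ f ≡ ∑⁴ g
    ∑⁴-cong f≗g = ∑-cong (allFin n) (λ a → ∑³-cong (f≗g a))

    ∑²-distrib-+ : ∀ (f g : Fin n → Fin n → ℕ) → ∑² (λ a b → f a b + g a b) ≡ ∑² f + ∑² g
    ∑²-distrib-+ f g = trans (∑-cong (allFin n) (λ a → ∑-distrib-+ (allFin n) (f a) (g a)))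
                             (∑-distrib-+ (allFin n) _ _)

    ∑³-distrib-+ : ∀ (f g : Fin n → Fin n → Fin n → ℕ) → ∑³ (λ a b c → f a b c + g a b c) ≡ ∑³ f + ∑³ g
    ∑³-distrib-+ f g = trans (∑-cong (allFin n) (λ a → ∑²-distrib-+ (f a) (g a)))
                             (∑-distrib-+ (allFin n) _ _)

    ∑⁴-distrib-+ : ∀ (f g : Fin n → Fin n → Fin n → Fin n → ℕ) →
                   ∑⁴ (λ a b c d → f a b c d + g a b c d) ≡ ∑⁴ f + ∑⁴ g
    ∑⁴-distrib-+ f g = trans (∑-cong (allFin n) (λ a → ∑³-distrib-+ (f a) (g a)))
                             (∑-distrib-+ (allFin n) _ _)

    ∑²-*ˡ : ∀ k (f : Fin n → Fin n → ℕ) → ∑² (λ a b → k * f a b) ≡ k * ∑² f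
    ∑²-*ˡ k f = trans (∑-cong (allFin n) (λ a → ∑-*ˡ (allFin n) k (f a))) (∑-*ˡ (allFin n) k _)

    ∑³-*ˡ : ∀ k (f : Fin n → Fin n → Fin n → ℕ) → ∑³ (λ a b c → k * f a b c) ≡ k * ∑³ f
    ∑³-*ˡ k f = trans (∑-cong (allFin n) (λ a → ∑²-*ˡ k (f a))) (∑-*ˡ (allFin n) k _)

    ∑⁴-*ˡ : ∀ k (f : Fin n → Fin n → Fin n → Fin n → ℕ) → ∑⁴ (λ a b c d → k * f a b c d) ≡ k * ∑⁴ f
    ∑⁴-*ˡ k f = trans (∑-cong (allFin n) (λ a → ∑³-*ˡ k (f a))) (∑-*ˡ (allFin n) k _)

    ∑²-comm : ∀ (f : Fin n → Fin n → ℕ) → ∑² f ≡ ∑² (λ a b → f b a)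
    ∑²-comm f = ∑-comm (allFin n) (allFin n) f

    ∑²-δˡ : ∀ x (F : Fin n → Fin n → ℕ) → ∑² (λ c d → 𝟙 (x == c) * F c d) ≡ ∑ (allFin n) (F x)
    ∑²-δˡ x F = trans (∑-cong (allFin n) (λ c → ∑-*ˡ (allFin n) (𝟙 (x == c)) (F c)))
                      (∑-δˡ n x (λ c → ∑ (allFin n) (F c)))

    ∑²-δʳ : ∀ x (F : Fin n → Fin n → ℕ) → ∑² (λ c d → 𝟙 (x == d) * F c d) ≡ ∑ (allFin n) (λ c → F c x)
    ∑²-δʳ x F = ∑-cong (allFin n) (λ c → ∑-δˡ n x (F c))

    ∑²-product : ∀ (f g : Fin n → Fin n → ℕ) → ∑² f * ∑² g ≡ ∑⁴ (λ a b c d → f a b * g c d)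
    ∑²-product f g = trans (sym (∑-*ʳ (allFin n) (∑² g) (λ a → ∑ (allFin n) (f a)))) (∑-cong (allFin n) λ a →
      trans (sym (∑-*ʳ (allFin n) (∑² g) (f a))) (∑-cong (allFin n) λ b →
        trans (sym (∑-*ˡ (allFin n) (f a b) _)) (∑-cong (allFin n) (λ c → sym (∑-*ˡ (allFin n) (f a b) (g c))))))

    ∑⁴-linear₃ : ∀ x y z (f g h : Fin n → Fin n → Fin n → Fin n → ℕ) →
                 ∑⁴ (λ a b c d → x * f a b c d + y * g a b c d + z * h a b c d) ≡ x * ∑⁴ f + y * ∑⁴ g + z * ∑⁴ h
    ∑⁴-linear₃ x y z f g h =
      trans (∑⁴-distrib-+ (λ a b c d → x * f a b c d + y * g a b c d) (λ a b c d → z * h a b c d))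
            (cong₂ _+_ (trans (∑⁴-distrib-+ (λ a b c d → x * f a b c d) (λ a b c d → y * g a b c d))
                              (cong₂ _+_ (∑⁴-*ˡ x f) (∑⁴-*ˡ y g)))
                       (∑⁴-*ˡ z h))

  module _ {A : Set} {n : ℕ} (xs : List A) where

    ∑-∑²-comm : ∀ (f : A → Fin n → Fin n → ℕ) → ∑ xs (λ x → ∑² (f x)) ≡ ∑² (λ a b → ∑ xs (λ x → f x a b))
    ∑-∑²-comm f = trans (∑-comm xs (allFin n) (λ x a → ∑ (allFin n) (f x a)))
                        (∑-cong (allFin n) (λ a → ∑-comm xs (allFin n) (λ x → f x a)))

    ∑-∑⁴-comm : ∀ (f : A → Fin n → Fin n → Fin n → Fin n → ℕ) →
                ∑ xs (λ x → ∑⁴ (f x)) ≡ ∑⁴ (λ a b c d → ∑ xs (λ x → f x a b c d))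
    ∑-∑⁴-comm f = trans (∑-∑²-comm (λ x a b → ∑² (f x a b)))
                        (∑²-cong (λ a b → ∑-∑²-comm (λ x → f x a b)))

module InjectiveVectors where

  open FiniteSums
  open import Defs using (allVecs; arrangements; injective?)
  open import Data.Bool using (Bool; true; false; _∧_; _∨_; not; if_then_else_)
  open import Data.Bool.Properties using (∧-assoc; ∧-zeroʳ; ∨-zeroʳ; ∧-conicalˡ; ∧-conicalʳ)
  open import Data.Maybe using (Maybe; just; nothing; is-just)
  open import Data.Nat using (ℕ; zero; suc; _+_; _*_; _∸_; _≤_; z≤n; s≤s; _!)
  open import Data.Nat.Properties
  open import Data.Nat.Combinatorics.Base using (_P′_)
  open import Data.Nat.Combinatorics.Specification using (nP′n≡n!)
  open import Data.Fin as Fin using (Fin; toℕ)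
  import Data.Fin.Properties as Fin
  open import Data.Vec as Vec using (Vec; []; _∷_; lookup; toList)
  import Data.Vec.Properties as Vec
  open import Data.List as List using (List; []; _∷_; _++_; allFin; length)
  import Data.List.Properties as List
  open import Data.Product using (∃; _,_)
  open import Data.Empty using (⊥-elim)
  open import Relation.Nullary using (¬_; does; yes)
  open import Relation.Nullary.Decidable using (dec-true; dec-false)
  open import Relation.Binary.PropositionalEquality
  open ≡-Reasoning

  𝟙-∧ : ∀ a b → 𝟙 (a ∧ b) ≡ 𝟙 a * 𝟙 b
  𝟙-∧ true  b = sym (+-identityʳ (𝟙 b))
  𝟙-∧ false b = refl

  not≡true⇒false : ∀ {b} → not b ≡ true → b ≡ false
  not≡true⇒false {false} _ = refl

  true≢false : ¬ true ≡ false
  true≢false ()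

  ∧-swap : ∀ p q r → p ∧ (q ∧ r) ≡ q ∧ (p ∧ r)
  ∧-swap true  q r = refl
  ∧-swap false q r = sym (∧-zeroʳ q)

  ∨-swap : ∀ p q r → p ∨ (q ∨ r) ≡ q ∨ (p ∨ r)
  ∨-swap true  q r = sym (∨-zeroʳ q)
  ∨-swap false q r = refl

  P′-step : ∀ n j k r → j ≤ k → ((n ∸ (j + r)) P′ (k ∸ j)) * (n ∸ (k + r)) ≡ (n ∸ (j + r)) P′ (suc k ∸ j)
  P′-step n j k r j≤k = begin
    (N P′ (k ∸ j)) * (n ∸ (k + r)) ≡⟨ *-comm (N P′ (k ∸ j)) _ ⟩
    (n ∸ (k + r)) * (N P′ (k ∸ j)) ≡⟨ cong (_* (N P′ (k ∸ j))) remaining ⟨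
    N P′ suc (k ∸ j)               ≡⟨ cong (N P′_) (+-∸-assoc 1 j≤k) ⟨
    N P′ (suc k ∸ j)               ∎
    where
    N = n ∸ (j + r)
    remaining : N ∸ (k ∸ j) ≡ n ∸ (k + r)
    remaining = trans (∸-+-assoc n (j + r) (k ∸ j)) (cong (n ∸_)
      (trans (+-comm (j + r) (k ∸ j)) (trans (sym (+-assoc (k ∸ j) j r)) (cong (_+ r) (m∸n+n≡m j≤k)))))

  module _ {n : ℕ} where

    infix 4 _∈ᵇ_
    _∈ᵇ_ : Fin n → List (Fin n) → Bool
    x ∈ᵇ []    = false
    x ∈ᵇ y ∷ L = (x == y) ∨ (x ∈ᵇ L)

    distinct : List (Fin n) → Bool
    distinct []      = true
    distinct (y ∷ L) = not (y ∈ᵇ L) ∧ distinct L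

    distinct-head : ∀ y L → distinct (y ∷ L) ≡ true → (y ∈ᵇ L) ≡ false
    distinct-head y L d = not≡true⇒false (∧-conicalˡ (not (y ∈ᵇ L)) (distinct L) d)

    distinct-tail : ∀ y L → distinct (y ∷ L) ≡ true → distinct L ≡ true
    distinct-tail y L d = ∧-conicalʳ (not (y ∈ᵇ L)) (distinct L) d

    ∑-∈ᵇ : ∀ L → distinct L ≡ true → ∑ (allFin n) (λ x → 𝟙 (x ∈ᵇ L)) ≡ length L
    ∑-∈ᵇ []      _  = ∑-zero (allFin n)
    ∑-∈ᵇ (y ∷ L) dL = begin
      ∑ (allFin n) (λ x → 𝟙 ((x == y) ∨ (x ∈ᵇ L)))
        ≡⟨ ∑-cong (allFin n) 𝟙-∨ ⟩
      ∑ (allFin n) (λ x → 𝟙 (x == y) * 1 + 𝟙 (x ∈ᵇ L))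
        ≡⟨ ∑-distrib-+ (allFin n) _ _ ⟩
      ∑ (allFin n) (λ x → 𝟙 (x == y) * 1) + ∑ (allFin n) (λ x → 𝟙 (x ∈ᵇ L))
        ≡⟨ cong₂ _+_ (∑-δ n y (λ _ → 1)) (∑-∈ᵇ L (distinct-tail y L dL)) ⟩
      suc (length L) ∎
      where
      𝟙-∨ : ∀ x → 𝟙 ((x == y) ∨ (x ∈ᵇ L)) ≡ 𝟙 (x == y) * 1 + 𝟙 (x ∈ᵇ L)
      𝟙-∨ x with x == y in x==y
      ... | false = refl
      ... | true = cong (λ b → suc (𝟙 b)) (sym (trans (cong (_∈ᵇ L) (==⇒≡ {x = x} {y} x==y)) (distinct-head y L dL)))

    ∑-∉ᵇ : ∀ L → distinct L ≡ true → ∑ (allFin n) (λ x → 𝟙 (not (x ∈ᵇ L))) ≡ n ∸ length L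
    ∑-∉ᵇ L dL = begin
      #out                           ≡⟨ m+n∸n≡m #out (length L) ⟨
      #out + length L ∸ length L     ≡⟨ cong (λ m → #out + m ∸ length L) (∑-∈ᵇ L dL) ⟨
      #out + #in ∸ length L          ≡⟨ cong (_∸ length L) partition ⟩
      n ∸ length L                   ∎
      where
      #out = ∑ (allFin n) (λ x → 𝟙 (not (x ∈ᵇ L)))
      #in  = ∑ (allFin n) (λ x → 𝟙 (x ∈ᵇ L))
      𝟙-not+𝟙 : ∀ b → 𝟙 (not b) + 𝟙 b ≡ 1
      𝟙-not+𝟙 true  = refl
      𝟙-not+𝟙 false = refl
      partition : #out + #in ≡ n
      partition = trans (sym (∑-distrib-+ (allFin n) _ _))
                        (trans (∑-cong (allFin n) (λ x → 𝟙-not+𝟙 (x ∈ᵇ L))) (∑-allFin-one n))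

    ∈ᵇ-++-∷ : ∀ x L a B → (x ∈ᵇ L ++ a ∷ B) ≡ (x == a) ∨ (x ∈ᵇ L ++ B)
    ∈ᵇ-++-∷ x []      a B = refl
    ∈ᵇ-++-∷ x (y ∷ L) a B = trans (cong ((x == y) ∨_) (∈ᵇ-++-∷ x L a B)) (∨-swap (x == y) (x == a) _)

    distinct-++-∷ : ∀ L a B → distinct (L ++ a ∷ B) ≡ not (a ∈ᵇ L ++ B) ∧ distinct (L ++ B)
    distinct-++-∷ []      a B = refl
    distinct-++-∷ (y ∷ L) a B
      rewrite ∈ᵇ-++-∷ y L a B | distinct-++-∷ L a B | ==-sym y a
      = reorder (a == y) (y ∈ᵇ L ++ B) (a ∈ᵇ L ++ B) (distinct (L ++ B))
      where
      reorder : ∀ p q r s → not (p ∨ q) ∧ (not r ∧ s) ≡ not (p ∨ r) ∧ (not q ∧ s)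
      reorder true  q r s = refl
      reorder false q r s = ∧-swap (not q) (not r) s

    ∑-allVecs-suc : ∀ k (f : Vec (Fin n) (suc k) → ℕ) →
                    ∑ (allVecs n (suc k)) f ≡ ∑ (allVecs n k) (λ w → ∑ (allFin n) (λ x → f (x ∷ w)))
    ∑-allVecs-suc k f = trans (∑-concatMap (λ w → List.map (_∷ w) (allFin n)) (allVecs n k) f)
                              (∑-cong (allVecs n k) (λ w → ∑-map (_∷ w) (allFin n) f))

    Constraint : ℕ → Set
    Constraint k = Fin k → Maybe (Fin n)

    fits : Fin n → Maybe (Fin n) → Bool
    fits x nothing  = true
    fits x (just a) = x == a

    tail : ∀ {k} → Constraint (suc k) → Constraint k
    tail c t = c (Fin.suc t)

    satisfies : ∀ {k} → Vec (Fin n) k → Constraint k → Bool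
    satisfies []      c = true
    satisfies (x ∷ v) c = fits x (c Fin.zero) ∧ satisfies v (tail c)

    #assigned : ∀ {k} → Constraint k → ℕ
    #assigned {zero}  c = 0
    #assigned {suc k} c = 𝟙 (is-just (c Fin.zero)) + #assigned (tail c)

    #assigned≡∑ : ∀ {k} (c : Constraint k) → #assigned c ≡ ∑ (allFin k) (λ t → 𝟙 (is-just (c t)))
    #assigned≡∑ {zero}  c = refl
    #assigned≡∑ {suc k} c = trans (cong (𝟙 (is-just (c Fin.zero)) +_) (#assigned≡∑ (tail c)))
                                  (sym (∑-allFin-suc k (λ t → 𝟙 (is-just (c t)))))

    #assigned≤ : ∀ {k} (c : Constraint k) → #assigned c ≤ k
    #assigned≤ {zero}  c = z≤n
    #assigned≤ {suc k} c with is-just (c Fin.zero)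
    ... | true  = s≤s (#assigned≤ (tail c))
    ... | false = m≤n⇒m≤1+n (#assigned≤ (tail c))

    Avoids : ∀ {k} → Constraint k → List (Fin n) → Set
    Avoids c B = ∀ t a → c t ≡ just a → (a ∈ᵇ B) ≡ false

    InjectiveConstraint : ∀ {k} → Constraint k → Set
    InjectiveConstraint c = ∀ t t′ a → c t ≡ just a → c t′ ≡ just a → t ≡ t′

    #solutions : ∀ k → Constraint k → List (Fin n) → ℕ
    #solutions k c B = ∑ (allVecs n k) (λ v → 𝟙 (distinct (toList v ++ B) ∧ satisfies v c))

    #solutions-assigned : ∀ k (c : Constraint (suc k)) B a → c Fin.zero ≡ just a →
                          #solutions (suc k) c B ≡ #solutions k (tail c) (a ∷ B)
    #solutions-assigned k c B a c₀≡a =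
      trans (∑-allVecs-suc k _) (∑-cong (allVecs n k) λ w →
        trans (∑-cong (allFin n) (pointwise w)) (∑-δ n a (λ _ → rest w)))
      where
      rest : Vec (Fin n) k → ℕ
      rest w = 𝟙 (distinct (toList w ++ a ∷ B) ∧ satisfies w (tail c))
      pointwise : ∀ w x → 𝟙 (distinct (toList (x ∷ w) ++ B) ∧ satisfies (x ∷ w) c) ≡ 𝟙 (x == a) * rest w
      pointwise w x rewrite c₀≡a with x == a in x==a
      ... | false = cong 𝟙 (∧-zeroʳ _)
      ... | true with refl ← ==⇒≡ {x = x} {a} x==a =
        sym (trans (+-identityʳ (rest w))
                   (cong (λ b → 𝟙 (b ∧ satisfies w (tail c))) (distinct-++-∷ (toList w) x B)))

    #solutions-free : ∀ k (c : Constraint (suc k)) B → c Fin.zero ≡ nothing →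
                      #solutions (suc k) c B ≡ #solutions k (tail c) B * (n ∸ (k + length B))
    #solutions-free k c B c₀≡nothing =
      trans (∑-allVecs-suc k _) (trans (∑-cong (allVecs n k) per-tail)
            (∑-*ʳ (allVecs n k) (n ∸ (k + length B)) _))
      where
      per-tail : ∀ w → ∑ (allFin n) (λ x → 𝟙 (distinct (toList (x ∷ w) ++ B) ∧ satisfies (x ∷ w) c))
                     ≡ 𝟙 (distinct (toList w ++ B) ∧ satisfies w (tail c)) * (n ∸ (k + length B))
      per-tail w rewrite c₀≡nothing = begin
        ∑ (allFin n) (λ x → 𝟙 ((not (x ∈ᵇ W) ∧ d) ∧ S))
          ≡⟨ ∑-cong (allFin n) (λ x → trans (cong 𝟙 (∧-assoc (not (x ∈ᵇ W)) d S)) (𝟙-∧ (not (x ∈ᵇ W)) (d ∧ S))) ⟩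
        ∑ (allFin n) (λ x → 𝟙 (not (x ∈ᵇ W)) * 𝟙 (d ∧ S))
          ≡⟨ ∑-*ʳ (allFin n) (𝟙 (d ∧ S)) _ ⟩
        ∑ (allFin n) (λ x → 𝟙 (not (x ∈ᵇ W))) * 𝟙 (d ∧ S)
          ≡⟨ count (d ∧ S) (∧-conicalˡ d S) ⟩
        𝟙 (d ∧ S) * (n ∸ (k + length B)) ∎
        where
        W = toList w ++ B
        d = distinct W
        S = satisfies w (tail c)
        count : ∀ b → (b ≡ true → d ≡ true) →
                ∑ (allFin n) (λ x → 𝟙 (not (x ∈ᵇ W))) * 𝟙 b ≡ 𝟙 b * (n ∸ (k + length B))
        count false _   = *-zeroʳ (∑ (allFin n) (λ x → 𝟙 (not (x ∈ᵇ W))))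
        count true  b⇒d = begin
          ∑ (allFin n) (λ x → 𝟙 (not (x ∈ᵇ W))) * 1 ≡⟨ *-identityʳ _ ⟩
          ∑ (allFin n) (λ x → 𝟙 (not (x ∈ᵇ W)))     ≡⟨ ∑-∉ᵇ W (b⇒d refl) ⟩
          n ∸ length W
            ≡⟨ cong (n ∸_) (trans (List.length-++ (toList w)) (cong (_+ length B) (Vec.length-toList w))) ⟩
          n ∸ (k + length B)                         ≡⟨ +-identityʳ _ ⟨
          1 * (n ∸ (k + length B))                   ∎

    injective-tail : ∀ {k} {c : Constraint (suc k)} → InjectiveConstraint c → InjectiveConstraint (tail c)
    injective-tail inj t t′ a e e′ = Fin.suc-injective (inj (Fin.suc t) (Fin.suc t′) a e e′)

    -- Fill the positions from the left: an assigned position admits one value, a free one any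
    -- value not used so far.
    #solutions≡ : ∀ k (c : Constraint k) B → distinct B ≡ true → Avoids c B → InjectiveConstraint c →
                  #solutions k c B ≡ (n ∸ (#assigned c + length B)) P′ (k ∸ #assigned c)
    #solutions≡ zero    c B dB _      _   rewrite dB = refl
    #solutions≡ (suc k) c B dB avoids inj with c Fin.zero in c₀
    ... | just a = begin
      #solutions (suc k) c B                 ≡⟨ #solutions-assigned k c B a c₀ ⟩
      #solutions k (tail c) (a ∷ B)          ≡⟨ #solutions≡ k (tail c) (a ∷ B) dB′ avoids′ (injective-tail inj) ⟩
      (n ∸ (J′ + suc r)) P′ (k ∸ J′)         ≡⟨ cong (λ m → (n ∸ m) P′ (k ∸ J′)) (+-suc J′ r) ⟩
      (n ∸ (suc J′ + r)) P′ (suc k ∸ suc J′) ∎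
      where
      J′ = #assigned (tail c)
      r = length B
      dB′ : distinct (a ∷ B) ≡ true
      dB′ rewrite avoids Fin.zero a c₀ = dB
      avoids′ : Avoids (tail c) (a ∷ B)
      avoids′ t b cₜ≡b with b == a in b==a
      ... | false = avoids (Fin.suc t) b cₜ≡b
      ... | true with refl ← ==⇒≡ {x = b} {a} b==a with () ← inj (Fin.suc t) Fin.zero b cₜ≡b c₀
    ... | nothing = begin
      #solutions (suc k) c B                       ≡⟨ #solutions-free k c B c₀ ⟩
      #solutions k (tail c) B * (n ∸ (k + r))
        ≡⟨ cong (_* (n ∸ (k + r))) (#solutions≡ k (tail c) B dB (λ t → avoids (Fin.suc t)) (injective-tail inj)) ⟩
      ((n ∸ (J′ + r)) P′ (k ∸ J′)) * (n ∸ (k + r)) ≡⟨ P′-step n J′ k r (#assigned≤ (tail c)) ⟩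
      (n ∸ (J′ + r)) P′ (suc k ∸ J′)               ∎
      where
      J′ = #assigned (tail c)
      r = length B

    prescribe : ∀ {j} → Vec (Fin n) j → Vec (Fin n) j → Constraint n
    prescribe []       []       t = nothing
    prescribe (u ∷ us) (b ∷ as) t = if t == u then just b else prescribe us as t

    prescribe-∉ : ∀ {j} (us as : Vec (Fin n) j) t → (t ∈ᵇ toList us) ≡ false → prescribe us as t ≡ nothing
    prescribe-∉ []       []       t _ = refl
    prescribe-∉ (u ∷ us) (b ∷ as) t t∉ with t == u
    ... | false = prescribe-∉ us as t t∉

    is-just-prescribe : ∀ {j} (us as : Vec (Fin n) j) t → is-just (prescribe us as t) ≡ (t ∈ᵇ toList us)
    is-just-prescribe []       []       t = refl
    is-just-prescribe (u ∷ us) (b ∷ as) t with t == u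
    ... | true  = refl
    ... | false = is-just-prescribe us as t

    #assigned-prescribe : ∀ {j} (us as : Vec (Fin n) j) → distinct (toList us) ≡ true →
                          #assigned (prescribe us as) ≡ j
    #assigned-prescribe {j} us as dus = begin
      #assigned (prescribe us as)                       ≡⟨ #assigned≡∑ (prescribe us as) ⟩
      ∑ (allFin n) (λ t → 𝟙 (is-just (prescribe us as t))) ≡⟨ ∑-cong (allFin n) (λ t → cong 𝟙 (is-just-prescribe us as t)) ⟩
      ∑ (allFin n) (λ t → 𝟙 (t ∈ᵇ toList us))            ≡⟨ ∑-∈ᵇ (toList us) dus ⟩
      length (toList us)                                ≡⟨ Vec.length-toList us ⟩
      j                                                 ∎

    prescribe⇒∈ᵇ : ∀ {j} (us as : Vec (Fin n) j) t b → prescribe us as t ≡ just b → (b ∈ᵇ toList as) ≡ true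
    prescribe⇒∈ᵇ []       []       t b ()
    prescribe⇒∈ᵇ (u ∷ us) (a ∷ as) t b e with t == u
    prescribe⇒∈ᵇ (u ∷ us) (a ∷ as) t b refl | true  rewrite ==-refl b = refl
    ... | false rewrite prescribe⇒∈ᵇ us as t b e = ∨-zeroʳ (b == a)

    prescribe-injective : ∀ {j} (us as : Vec (Fin n) j) → distinct (toList as) ≡ true →
                          InjectiveConstraint (prescribe us as)
    prescribe-injective []       []       d t t′ b ()
    prescribe-injective (u ∷ us) (a ∷ as) d t t′ b e e′ with t == u in t==u | t′ == u in t′==u
    ... | true  | true  = trans (==⇒≡ {x = t} {u} t==u) (sym (==⇒≡ {x = t′} {u} t′==u))
    ... | true  | false with refl ← e = ⊥-elim (true≢false (trans (sym (prescribe⇒∈ᵇ us as t′ a e′)) (distinct-head a (toList as) d)))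
    ... | false | true  with refl ← e′ = ⊥-elim (true≢false (trans (sym (prescribe⇒∈ᵇ us as t a e)) (distinct-head a (toList as) d)))
    ... | false | false = prescribe-injective us as (distinct-tail a (toList as) d) t t′ b e e′

    satisfies-nothing : ∀ {k} (v : Vec (Fin n) k) → satisfies v (λ _ → nothing) ≡ true
    satisfies-nothing []      = refl
    satisfies-nothing (x ∷ v) = satisfies-nothing v

    satisfies-assign : ∀ {k} (v : Vec (Fin n) k) u b (c : Constraint k) → c u ≡ nothing →
                       satisfies v (λ t → if t == u then just b else c t) ≡ (lookup v u == b) ∧ satisfies v c
    satisfies-assign (x ∷ v) Fin.zero    b c cu rewrite cu = refl
    satisfies-assign (x ∷ v) (Fin.suc u) b c cu =
      trans (cong (fits x (c Fin.zero) ∧_) (satisfies-assign v u b (tail c) cu))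
            (∧-swap (fits x (c Fin.zero)) (lookup v u == b) _)

    infix 4 _=ᵛ_
    _=ᵛ_ : ∀ {j} → Vec (Fin n) j → Vec (Fin n) j → Bool
    v =ᵛ w = does (Vec.≡-dec Fin._≟_ v w)

    satisfies-prescribe : ∀ {j} (π : Vec (Fin n) n) (us as : Vec (Fin n) j) → distinct (toList us) ≡ true →
                          satisfies π (prescribe us as) ≡ (Vec.map (lookup π) us =ᵛ as)
    satisfies-prescribe π []       []       _   = satisfies-nothing π
    satisfies-prescribe π (u ∷ us) (b ∷ as) dus =
      trans (satisfies-assign π u b (prescribe us as) (prescribe-∉ us as u (distinct-head u (toList us) dus)))
            (cong ((lookup π u == b) ∧_) (satisfies-prescribe π us as (distinct-tail u (toList us) dus)))

    Injective : ∀ {k} → Vec (Fin n) k → Set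
    Injective v = ∀ i j → lookup v i ≡ lookup v j → i ≡ j

    ∈ᵇ⇒lookup : ∀ {k} x (v : Vec (Fin n) k) → (x ∈ᵇ toList v) ≡ true → ∃ λ i → lookup v i ≡ x
    ∈ᵇ⇒lookup x (y ∷ v) x∈ with x == y in x==y
    ... | true  = Fin.zero , sym (==⇒≡ {x = x} {y} x==y)
    ... | false with i , vᵢ≡x ← ∈ᵇ⇒lookup x v x∈ = Fin.suc i , vᵢ≡x

    lookup⇒∈ᵇ : ∀ {k} (v : Vec (Fin n) k) i → (lookup v i ∈ᵇ toList v) ≡ true
    lookup⇒∈ᵇ (y ∷ v) Fin.zero    rewrite ==-refl y = refl
    lookup⇒∈ᵇ (y ∷ v) (Fin.suc i) rewrite lookup⇒∈ᵇ v i = ∨-zeroʳ _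

    distinct⇒injective : ∀ {k} (v : Vec (Fin n) k) → distinct (toList v) ≡ true → Injective v
    distinct⇒injective (x ∷ v) d Fin.zero    Fin.zero    _ = refl
    distinct⇒injective (x ∷ v) d Fin.zero    (Fin.suc j) x≡vⱼ =
      ⊥-elim (true≢false (trans (sym (subst (λ y → (y ∈ᵇ toList v) ≡ true) (sym x≡vⱼ) (lookup⇒∈ᵇ v j)))
                                (distinct-head x (toList v) d)))
    distinct⇒injective (x ∷ v) d (Fin.suc i) Fin.zero    vᵢ≡x =
      ⊥-elim (true≢false (trans (sym (subst (λ y → (y ∈ᵇ toList v) ≡ true) vᵢ≡x (lookup⇒∈ᵇ v i)))
                                (distinct-head x (toList v) d)))
    distinct⇒injective (x ∷ v) d (Fin.suc i) (Fin.suc j) vᵢ≡vⱼ =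
      cong Fin.suc (distinct⇒injective v (distinct-tail x (toList v) d) i j vᵢ≡vⱼ)

    injective⇒distinct : ∀ {k} (v : Vec (Fin n) k) → Injective v → distinct (toList v) ≡ true
    injective⇒distinct []      _   = refl
    injective⇒distinct (x ∷ v) inj with x ∈ᵇ toList v in x∈v
    ... | true with i , vᵢ≡x ← ∈ᵇ⇒lookup x v x∈v with () ← inj Fin.zero (Fin.suc i) (sym vᵢ≡x)
    ... | false = injective⇒distinct v (λ i j vᵢ≡vⱼ → Fin.suc-injective (inj (Fin.suc i) (Fin.suc j) vᵢ≡vⱼ))

    does-injective? : (v : Vec (Fin n) n) → does (injective? v) ≡ distinct (toList v)
    does-injective? v with distinct (toList v) in d
    ... | true  = dec-true (injective? v) (distinct⇒injective v d)
    ... | false = dec-false (injective? v) (λ inj → true≢false (trans (sym (injective⇒distinct v inj)) d))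

    distinct⇒≤ : ∀ {k} (v : Vec (Fin n) k) → distinct (toList v) ≡ true → k ≤ n
    distinct⇒≤ v d = ≮⇒≥ λ n<k →
      let i , j , i<j , vᵢ≡vⱼ = Fin.pigeonhole n<k (lookup v)
      in <-irrefl (cong toℕ (distinct⇒injective v d i j vᵢ≡vⱼ)) i<j

    distinct-map-lookup : ∀ {j} (π : Vec (Fin n) n) (us : Vec (Fin n) j) →
                          distinct (toList π) ≡ true → distinct (toList us) ≡ true →
                          distinct (toList (Vec.map (lookup π) us)) ≡ true
    distinct-map-lookup π us dπ dus = injective⇒distinct (Vec.map (lookup π) us) λ i j e →
      distinct⇒injective us dus i j (distinct⇒injective π dπ _ _
        (trans (sym (Vec.lookup-map i (lookup π) us)) (trans e (Vec.lookup-map j (lookup π) us))))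

    =ᵛ⇒≡ : ∀ {j} {v w : Vec (Fin n) j} → (v =ᵛ w) ≡ true → v ≡ w
    =ᵛ⇒≡ {v = v} {w} e with Vec.≡-dec Fin._≟_ v w
    ... | yes v≡w = v≡w

    ∑-δᵛ : ∀ j (v : Vec (Fin n) j) (g : Vec (Fin n) j → ℕ) → ∑ (allVecs n j) (λ a → 𝟙 (v =ᵛ a) * g a) ≡ g v
    ∑-δᵛ zero    []      g = trans (+-identityʳ _) (+-identityʳ _)
    ∑-δᵛ (suc j) (x ∷ v) g = begin
      ∑ (allVecs n (suc j)) (λ a → 𝟙 ((x ∷ v) =ᵛ a) * g a)
        ≡⟨ ∑-allVecs-suc j _ ⟩
      ∑ (allVecs n j) (λ w → ∑ (allFin n) (λ y → 𝟙 ((x == y) ∧ (v =ᵛ w)) * g (y ∷ w)))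
        ≡⟨ ∑-cong (allVecs n j) (λ w → ∑-cong (allFin n) (λ y → 𝟙-∧-swap (x == y) (v =ᵛ w) (g (y ∷ w)))) ⟩
      ∑ (allVecs n j) (λ w → ∑ (allFin n) (λ y → 𝟙 (x == y) * (𝟙 (v =ᵛ w) * g (y ∷ w))))
        ≡⟨ ∑-cong (allVecs n j) (λ w → ∑-δˡ n x (λ y → 𝟙 (v =ᵛ w) * g (y ∷ w))) ⟩
      ∑ (allVecs n j) (λ w → 𝟙 (v =ᵛ w) * g (x ∷ w))
        ≡⟨ ∑-δᵛ j v (λ w → g (x ∷ w)) ⟩
      g (x ∷ v) ∎
      where
      𝟙-∧-swap : ∀ p q m → 𝟙 (p ∧ q) * m ≡ 𝟙 p * (𝟙 q * m)
      𝟙-∧-swap p q m = trans (cong (_* m) (𝟙-∧ p q)) (*-assoc (𝟙 p) (𝟙 q) m)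

    ∑-arrangements : (F : Vec (Fin n) n → ℕ) →
                     ∑ (arrangements n) F ≡ ∑ (allVecs n n) (λ π → 𝟙 (distinct (toList π)) * F π)
    ∑-arrangements F = trans (∑-filterᵇ (λ v → does (injective? v)) (allVecs n n) F)
                             (∑-cong (allVecs n n) (λ π → cong (λ b → 𝟙 b * F π) (does-injective? π)))

    #arrangements-extending : ∀ {j} (us as : Vec (Fin n) j) → distinct (toList us) ≡ true →
      ∑ (allVecs n n) (λ π → 𝟙 (distinct (toList π) ∧ (Vec.map (lookup π) us =ᵛ as))) ≡ 𝟙 (distinct (toList as)) * (n ∸ j) !
    #arrangements-extending {j} us as dus with distinct (toList as) in das
    ... | true = begin
      ∑ (allVecs n n) (λ π → 𝟙 (distinct (toList π) ∧ (Vec.map (lookup π) us =ᵛ as)))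
        ≡⟨ ∑-cong (allVecs n n) (λ π → cong₂ (λ L b → 𝟙 (distinct L ∧ b)) (sym (List.++-identityʳ (toList π)))
                                                                         (sym (satisfies-prescribe π us as dus))) ⟩
      #solutions n (prescribe us as) []
        ≡⟨ #solutions≡ n (prescribe us as) [] refl (λ _ _ _ → refl) (prescribe-injective us as das) ⟩
      (n ∸ (#assigned (prescribe us as) + 0)) P′ (n ∸ #assigned (prescribe us as))
        ≡⟨ cong (λ J → (n ∸ (J + 0)) P′ (n ∸ J)) (#assigned-prescribe us as dus) ⟩
      (n ∸ (j + 0)) P′ (n ∸ j)
        ≡⟨ cong (λ m → (n ∸ m) P′ (n ∸ j)) (+-identityʳ j) ⟩
      (n ∸ j) P′ (n ∸ j)
        ≡⟨ nP′n≡n! (n ∸ j) ⟩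
      (n ∸ j) !
        ≡⟨ +-identityʳ _ ⟨
      1 * (n ∸ j) ! ∎
    ... | false = trans (∑-cong (allVecs n n) (λ π → cong 𝟙 (no-extension π))) (∑-zero (allVecs n n))
      where
      no-extension : ∀ π → distinct (toList π) ∧ (Vec.map (lookup π) us =ᵛ as) ≡ false
      no-extension π with distinct (toList π) in dπ | Vec.map (lookup π) us =ᵛ as in π∘us=as
      ... | false | _     = refl
      ... | true  | false = refl
      ... | true  | true  = ⊥-elim (true≢false (trans (sym (subst (λ v → distinct (toList v) ≡ true)
                                      (=ᵛ⇒≡ {v = Vec.map (lookup π) us} {as} π∘us=as) (distinct-map-lookup π us dπ dus))) das))

    ∑-arrangements-restrict : ∀ {j} (us : Vec (Fin n) j) → distinct (toList us) ≡ true → (g : Vec (Fin n) j → ℕ) →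
      ∑ (arrangements n) (λ π → g (Vec.map (lookup π) us)) ≡ (n ∸ j) ! * ∑ (allVecs n j) (λ a → 𝟙 (distinct (toList a)) * g a)
    ∑-arrangements-restrict {j} us dus g = begin
      ∑ (arrangements n) (λ π → g (π∘us π))
        ≡⟨ ∑-arrangements (λ π → g (π∘us π)) ⟩
      ∑ (allVecs n n) (λ π → 𝟙 (distinct (toList π)) * g (π∘us π))
        ≡⟨ ∑-cong (allVecs n n) (λ π → cong (𝟙 (distinct (toList π)) *_) (sym (∑-δᵛ j (π∘us π) g))) ⟩
      ∑ (allVecs n n) (λ π → 𝟙 (distinct (toList π)) * ∑ (allVecs n j) (λ a → 𝟙 (π∘us π =ᵛ a) * g a))
        ≡⟨ ∑-cong (allVecs n n) (λ π → sym (∑-*ˡ (allVecs n j) (𝟙 (distinct (toList π))) _)) ⟩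
      ∑ (allVecs n n) (λ π → ∑ (allVecs n j) (λ a → 𝟙 (distinct (toList π)) * (𝟙 (π∘us π =ᵛ a) * g a)))
        ≡⟨ ∑-comm (allVecs n n) (allVecs n j) _ ⟩
      ∑ (allVecs n j) (λ a → ∑ (allVecs n n) (λ π → 𝟙 (distinct (toList π)) * (𝟙 (π∘us π =ᵛ a) * g a)))
        ≡⟨ ∑-cong (allVecs n j) (λ a → trans (∑-cong (allVecs n n) (λ π → regroup π a))
                                             (∑-*ʳ (allVecs n n) (g a) _)) ⟩
      ∑ (allVecs n j) (λ a → ∑ (allVecs n n) (λ π → 𝟙 (distinct (toList π) ∧ (π∘us π =ᵛ a))) * g a)
        ≡⟨ ∑-cong (allVecs n j) (λ a → cong (_* g a) (#arrangements-extending us a dus)) ⟩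
      ∑ (allVecs n j) (λ a → 𝟙 (distinct (toList a)) * (n ∸ j) ! * g a)
        ≡⟨ ∑-cong (allVecs n j) (λ a → trans (cong (_* g a) (*-comm (𝟙 (distinct (toList a))) ((n ∸ j) !)))
                                             (*-assoc ((n ∸ j) !) _ (g a))) ⟩
      ∑ (allVecs n j) (λ a → (n ∸ j) ! * (𝟙 (distinct (toList a)) * g a))
        ≡⟨ ∑-*ˡ (allVecs n j) ((n ∸ j) !) _ ⟩
      (n ∸ j) ! * ∑ (allVecs n j) (λ a → 𝟙 (distinct (toList a)) * g a) ∎
      where
      π∘us : Vec (Fin n) n → Vec (Fin n) j
      π∘us π = Vec.map (lookup π) us
      regroup : ∀ π a → 𝟙 (distinct (toList π)) * (𝟙 (π∘us π =ᵛ a) * g a) ≡ 𝟙 (distinct (toList π) ∧ (π∘us π =ᵛ a)) * g a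
      regroup π a = trans (sym (*-assoc (𝟙 (distinct (toList π))) _ (g a)))
                          (cong (_* g a) (sym (𝟙-∧ (distinct (toList π)) _)))

    distinct₂ : ∀ {a b : Fin n} → ¬ a ≡ b → distinct (a ∷ b ∷ []) ≡ true
    distinct₂ a≢b rewrite ≢⇒==false a≢b = refl

    distinct₃ : ∀ {a b c : Fin n} → ¬ a ≡ b → ¬ a ≡ c → ¬ b ≡ c → distinct (a ∷ b ∷ c ∷ []) ≡ true
    distinct₃ a≢b a≢c b≢c rewrite ≢⇒==false a≢b | ≢⇒==false a≢c | ≢⇒==false b≢c = refl

    distinct₄ : ∀ {a b c d : Fin n} → ¬ a ≡ b → ¬ a ≡ c → ¬ a ≡ d → ¬ b ≡ c → ¬ b ≡ d → ¬ c ≡ d →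
                distinct (a ∷ b ∷ c ∷ d ∷ []) ≡ true
    distinct₄ a≢b a≢c a≢d b≢c b≢d c≢d
      rewrite ≢⇒==false a≢b | ≢⇒==false a≢c | ≢⇒==false a≢d | ≢⇒==false b≢c | ≢⇒==false b≢d | ≢⇒==false c≢d = refl

module DistanceSums where

  open import Data.Nat using (ℕ; zero; suc; _+_; _*_; _∸_; _<_; s≤s; z≤n; ∣_-_∣)
  open import Data.Nat.Properties
  open import Data.Nat.Tactic.RingSolver using (solve-∀)
  open import Relation.Binary.PropositionalEquality
  open ≡-Reasoning

  ∑< : ℕ → (ℕ → ℕ) → ℕ
  ∑< zero    f = 0
  ∑< (suc n) f = f 0 + ∑< n (λ a → f (suc a))

  ∑<-last : ∀ n (f : ℕ → ℕ) → ∑< (suc n) f ≡ ∑< n f + f n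
  ∑<-last zero    f = +-identityʳ (f 0)
  ∑<-last (suc n) f = trans (cong (f 0 +_) (∑<-last n (λ a → f (suc a)))) (sym (+-assoc (f 0) _ _))

  ∑<-cong : ∀ n {f g : ℕ → ℕ} → (∀ a → a < n → f a ≡ g a) → ∑< n f ≡ ∑< n g
  ∑<-cong zero    f≗g = refl
  ∑<-cong (suc n) f≗g = cong₂ _+_ (f≗g 0 (s≤s z≤n)) (∑<-cong n (λ a a<n → f≗g (suc a) (s≤s a<n)))

  ∑<-distrib-+ : ∀ n (f g : ℕ → ℕ) → ∑< n (λ a → f a + g a) ≡ ∑< n f + ∑< n g
  ∑<-distrib-+ zero    f g = refl
  ∑<-distrib-+ (suc n) f g = trans (cong (f 0 + g 0 +_) (∑<-distrib-+ n _ _))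
                                  (interchange (f 0) (g 0) (∑< n (λ a → f (suc a))) (∑< n (λ a → g (suc a))))
    where
    interchange : ∀ a b c d → a + b + (c + d) ≡ a + c + (b + d)
    interchange = solve-∀

  ∑<-*ˡ : ∀ n c (f : ℕ → ℕ) → ∑< n (λ a → c * f a) ≡ c * ∑< n f
  ∑<-*ˡ zero    c f = sym (*-zeroʳ c)
  ∑<-*ˡ (suc n) c f = trans (cong (c * f 0 +_) (∑<-*ˡ n c _)) (sym (*-distribˡ-+ c (f 0) _))

  ∑<-reverse : ∀ n (f : ℕ → ℕ) → ∑< (suc n) (λ a → f (n ∸ a)) ≡ ∑< (suc n) f
  ∑<-reverse zero    f = refl
  ∑<-reverse (suc n) f = begin
    f (suc n) + ∑< (suc n) (λ a → f (n ∸ a)) ≡⟨ cong (f (suc n) +_) (∑<-reverse n f) ⟩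
    f (suc n) + ∑< (suc n) f                 ≡⟨ +-comm (f (suc n)) _ ⟩
    ∑< (suc n) f + f (suc n)                 ≡⟨ ∑<-last (suc n) f ⟨
    ∑< (suc (suc n)) f                       ∎

  ∑<-reverse-suc : ∀ n (f : ℕ → ℕ) → ∑< n (λ a → f (n ∸ a)) ≡ ∑< n (λ a → f (suc a))
  ∑<-reverse-suc zero    f = refl
  ∑<-reverse-suc (suc n) f = trans (∑<-cong (suc n) (λ a a<n → cong f (+-∸-assoc 1 (≤-pred a<n))))
                            (∑<-reverse n (λ a → f (suc a)))

  triangular : ℕ → ℕ
  triangular n = ∑< n suc

  squarePyramidal : ℕ → ℕ
  squarePyramidal n = ∑< n (λ a → suc a * suc a)

  triangular-closed : ∀ n → 2 * triangular n ≡ n * suc n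
  triangular-closed zero    = refl
  triangular-closed (suc n) = begin
    2 * triangular (suc n)       ≡⟨ cong (2 *_) (∑<-last n suc) ⟩
    2 * (triangular n + suc n)   ≡⟨ *-distribˡ-+ 2 (triangular n) _ ⟩
    2 * triangular n + 2 * suc n ≡⟨ cong (_+ 2 * suc n) (triangular-closed n) ⟩
    n * suc n + 2 * suc n        ≡⟨ poly n ⟩
    suc n * suc (suc n)          ∎
    where
    poly : ∀ n → n * suc n + 2 * suc n ≡ suc n * suc (suc n)
    poly = solve-∀

  squarePyramidal-closed : ∀ n → 6 * squarePyramidal n ≡ n * suc n * (2 * n + 1)
  squarePyramidal-closed zero    = refl
  squarePyramidal-closed (suc n) = begin
    6 * squarePyramidal (suc n)                     ≡⟨ cong (6 *_) (∑<-last n (λ a → suc a * suc a)) ⟩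
    6 * (squarePyramidal n + suc n * suc n)         ≡⟨ *-distribˡ-+ 6 (squarePyramidal n) _ ⟩
    6 * squarePyramidal n + 6 * (suc n * suc n)     ≡⟨ cong (_+ 6 * (suc n * suc n)) (squarePyramidal-closed n) ⟩
    n * suc n * (2 * n + 1) + 6 * (suc n * suc n)   ≡⟨ poly n ⟩
    suc n * suc (suc n) * (2 * suc n + 1)           ∎
    where
    poly : ∀ n → n * suc n * (2 * n + 1) + 6 * (suc n * suc n) ≡ suc n * suc (suc n) * (2 * suc n + 1)
    poly = solve-∀

  rowDist : ℕ → ℕ → ℕ
  rowDist n a = ∑< n (λ b → ∣ a - b ∣)

  rowSqDist : ℕ → ℕ → ℕ
  rowSqDist n a = ∑< n (λ b → ∣ a - b ∣ * ∣ a - b ∣)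

  totalDist : ℕ → ℕ
  totalDist n = ∑< n (rowDist n)

  totalSqDist : ℕ → ℕ
  totalSqDist n = ∑< n (rowSqDist n)

  rowDistSquares : ℕ → ℕ
  rowDistSquares n = ∑< n (λ a → rowDist n a * rowDist n a)

  weightedRowDist : ℕ → ℕ
  weightedRowDist n = ∑< n (λ a → rowDist n a * (n ∸ a))

  ∣a-n∣≡n∸a : ∀ {a n} → a < n → ∣ a - n ∣ ≡ n ∸ a
  ∣a-n∣≡n∸a a<n = m≤n⇒∣m-n∣≡n∸m (<⇒≤ a<n)

  rowDist-step : ∀ n a → a < n → rowDist (suc n) a ≡ rowDist n a + (n ∸ a)
  rowDist-step n a a<n = trans (∑<-last n (λ b → ∣ a - b ∣)) (cong (rowDist n a +_) (∣a-n∣≡n∸a a<n))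

  rowSqDist-step : ∀ n a → a < n → rowSqDist (suc n) a ≡ rowSqDist n a + (n ∸ a) * (n ∸ a)
  rowSqDist-step n a a<n = trans (∑<-last n (λ b → ∣ a - b ∣ * ∣ a - b ∣))
                                 (cong (λ d → rowSqDist n a + d * d) (∣a-n∣≡n∸a a<n))

  rowDist-last : ∀ n → rowDist (suc n) n ≡ triangular n
  rowDist-last n = trans (∑<-cong (suc n) (λ b b≤n → m≤n⇒∣n-m∣≡n∸m (≤-pred b≤n))) (∑<-reverse n (λ c → c))

  rowSqDist-last : ∀ n → rowSqDist (suc n) n ≡ squarePyramidal n
  rowSqDist-last n = trans (∑<-cong (suc n) (λ b b≤n → cong (λ d → d * d) (m≤n⇒∣n-m∣≡n∸m (≤-pred b≤n))))
                           (∑<-reverse n (λ c → c * c))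

  totalDist-step : ∀ n → totalDist (suc n) ≡ totalDist n + triangular n + triangular n
  totalDist-step n = begin
    ∑< (suc n) (rowDist (suc n))                         ≡⟨ ∑<-last n (rowDist (suc n)) ⟩
    ∑< n (rowDist (suc n)) + rowDist (suc n) n           ≡⟨ cong₂ _+_ (∑<-cong n (rowDist-step n)) (rowDist-last n) ⟩
    ∑< n (λ a → rowDist n a + (n ∸ a)) + triangular n
      ≡⟨ cong (_+ triangular n) (trans (∑<-distrib-+ n (rowDist n) (n ∸_)) (cong (totalDist n +_) (∑<-reverse-suc n (λ c → c)))) ⟩
    totalDist n + triangular n + triangular n            ∎

  totalSqDist-step : ∀ n → totalSqDist (suc n) ≡ totalSqDist n + squarePyramidal n + squarePyramidal n
  totalSqDist-step n = begin
    ∑< (suc n) (rowSqDist (suc n))                        ≡⟨ ∑<-last n (rowSqDist (suc n)) ⟩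
    ∑< n (rowSqDist (suc n)) + rowSqDist (suc n) n        ≡⟨ cong₂ _+_ (∑<-cong n (rowSqDist-step n)) (rowSqDist-last n) ⟩
    ∑< n (λ a → rowSqDist n a + (n ∸ a) * (n ∸ a)) + squarePyramidal n
      ≡⟨ cong (_+ squarePyramidal n) (trans (∑<-distrib-+ n (rowSqDist n) (λ a → (n ∸ a) * (n ∸ a)))
                                            (cong (totalSqDist n +_) (∑<-reverse-suc n (λ c → c * c)))) ⟩
    totalSqDist n + squarePyramidal n + squarePyramidal n ∎

  weightedRowDist-step : ∀ n → weightedRowDist (suc n) ≡
    weightedRowDist n + totalDist n + squarePyramidal n + triangular n + triangular n
  weightedRowDist-step n = begin
    ∑< (suc n) (λ a → rowDist (suc n) a * (suc n ∸ a))
      ≡⟨ ∑<-last n _ ⟩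
    ∑< n (λ a → rowDist (suc n) a * (suc n ∸ a)) + rowDist (suc n) n * (suc n ∸ n)
      ≡⟨ cong₂ _+_ (∑<-cong n (λ a a<n → trans (cong₂ _*_ (rowDist-step n a a<n) (+-∸-assoc 1 (<⇒≤ a<n)))
                                                (expand (rowDist n a) (n ∸ a))))
                   (trans (cong₂ _*_ (rowDist-last n) (m+n∸n≡m 1 n)) (*-identityʳ _)) ⟩
    ∑< n (λ a → rowDist n a * (n ∸ a) + rowDist n a + (n ∸ a) * (n ∸ a) + (n ∸ a)) + triangular n
      ≡⟨ cong (_+ triangular n) (trans (∑<-distrib-+ n _ _) (cong₂ _+_ (trans (∑<-distrib-+ n _ _)
           (cong₂ _+_ (∑<-distrib-+ n _ _) (∑<-reverse-suc n (λ c → c * c)))) (∑<-reverse-suc n (λ c → c)))) ⟩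
    weightedRowDist n + totalDist n + squarePyramidal n + triangular n + triangular n ∎
    where
    expand : ∀ r d → (r + d) * suc d ≡ r * d + r + d * d + d
    expand = solve-∀

  rowDistSquares-step : ∀ n → rowDistSquares (suc n) ≡
    rowDistSquares n + 2 * weightedRowDist n + squarePyramidal n + triangular n * triangular n
  rowDistSquares-step n = begin
    ∑< (suc n) (λ a → rowDist (suc n) a * rowDist (suc n) a)
      ≡⟨ ∑<-last n _ ⟩
    ∑< n (λ a → rowDist (suc n) a * rowDist (suc n) a) + rowDist (suc n) n * rowDist (suc n) n
      ≡⟨ cong₂ _+_ (∑<-cong n (λ a a<n → trans (cong (λ r → r * r) (rowDist-step n a a<n))
                                                (expand (rowDist n a) (n ∸ a))))
                   (cong (λ r → r * r) (rowDist-last n)) ⟩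
    ∑< n (λ a → rowDist n a * rowDist n a + 2 * (rowDist n a * (n ∸ a)) + (n ∸ a) * (n ∸ a))
      + triangular n * triangular n
      ≡⟨ cong (_+ triangular n * triangular n) (trans (∑<-distrib-+ n _ _) (cong₂ _+_
           (trans (∑<-distrib-+ n _ _) (cong (rowDistSquares n +_) (∑<-*ˡ n 2 _))) (∑<-reverse-suc n (λ c → c * c)))) ⟩
    rowDistSquares n + 2 * weightedRowDist n + squarePyramidal n + triangular n * triangular n ∎
    where
    expand : ∀ r d → (r + d) * (r + d) ≡ r * r + 2 * (r * d) + d * d
    expand = solve-∀

  totalDist-closed : ∀ k → 3 * totalDist (suc k) ≡ k * suc k * (k + 2)
  totalDist-closed zero    = refl
  totalDist-closed (suc k) = begin
    3 * totalDist (suc (suc k))                   ≡⟨ cong (3 *_) (totalDist-step (suc k)) ⟩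
    3 * (T + R + R)                               ≡⟨ regroup T R ⟩
    3 * T + 3 * (2 * R)                           ≡⟨ cong₂ (λ x y → x + 3 * y) (totalDist-closed k) (triangular-closed (suc k)) ⟩
    k * suc k * (k + 2) + 3 * (suc k * suc (suc k)) ≡⟨ poly k ⟩
    suc k * suc (suc k) * (suc k + 2)             ∎
    where
    T = totalDist (suc k)
    R = triangular (suc k)
    regroup : ∀ T R → 3 * (T + R + R) ≡ 3 * T + 3 * (2 * R)
    regroup = solve-∀
    poly : ∀ k → k * suc k * (k + 2) + 3 * (suc k * suc (suc k)) ≡ suc k * suc (suc k) * (suc k + 2)
    poly = solve-∀

  totalSqDist-closed : ∀ k → 6 * totalSqDist (suc k) ≡ k * suc k * suc k * (k + 2)
  totalSqDist-closed zero    = refl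
  totalSqDist-closed (suc k) = begin
    6 * totalSqDist (suc (suc k))                 ≡⟨ cong (6 *_) (totalSqDist-step (suc k)) ⟩
    6 * (B + P + P)                               ≡⟨ regroup B P ⟩
    6 * B + 2 * (6 * P)                           ≡⟨ cong₂ (λ x y → x + 2 * y) (totalSqDist-closed k) (squarePyramidal-closed (suc k)) ⟩
    k * suc k * suc k * (k + 2) + 2 * (suc k * suc (suc k) * (2 * suc k + 1)) ≡⟨ poly k ⟩
    suc k * suc (suc k) * suc (suc k) * (suc k + 2) ∎
    where
    B = totalSqDist (suc k)
    P = squarePyramidal (suc k)
    regroup : ∀ B P → 6 * (B + P + P) ≡ 6 * B + 2 * (6 * P)
    regroup = solve-∀
    poly : ∀ k → k * suc k * suc k * (k + 2) + 2 * (suc k * suc (suc k) * (2 * suc k + 1))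
               ≡ suc k * suc (suc k) * suc (suc k) * (suc k + 2)
    poly = solve-∀

  weightedRowDist-closed : ∀ k → 6 * weightedRowDist (suc k) ≡ k * suc k * (k + 2) * (k + 2)
  weightedRowDist-closed zero    = refl
  weightedRowDist-closed (suc k) = begin
    6 * weightedRowDist (suc (suc k))             ≡⟨ cong (6 *_) (weightedRowDist-step (suc k)) ⟩
    6 * (W + T + P + R + R)                       ≡⟨ regroup W T P R ⟩
    6 * W + 2 * (3 * T) + 6 * P + 6 * (2 * R)
      ≡⟨ cong₂ _+_ (cong₂ _+_ (cong₂ (λ x y → x + 2 * y) (weightedRowDist-closed k) (totalDist-closed k))
                              (squarePyramidal-closed (suc k)))
                   (cong (6 *_) (triangular-closed (suc k))) ⟩
    k * suc k * (k + 2) * (k + 2) + 2 * (k * suc k * (k + 2)) + suc k * suc (suc k) * (2 * suc k + 1)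
      + 6 * (suc k * suc (suc k))                 ≡⟨ poly k ⟩
    suc k * suc (suc k) * (suc k + 2) * (suc k + 2) ∎
    where
    W = weightedRowDist (suc k)
    T = totalDist (suc k)
    P = squarePyramidal (suc k)
    R = triangular (suc k)
    regroup : ∀ W T P R → 6 * (W + T + P + R + R) ≡ 6 * W + 2 * (3 * T) + 6 * P + 6 * (2 * R)
    regroup = solve-∀
    poly : ∀ k → k * suc k * (k + 2) * (k + 2) + 2 * (k * suc k * (k + 2))
                 + suc k * suc (suc k) * (2 * suc k + 1) + 6 * (suc k * suc (suc k))
               ≡ suc k * suc (suc k) * (suc k + 2) * (suc k + 2)
    poly = solve-∀

  rowDistSquares-closed : ∀ k → 60 * rowDistSquares (2 + k) ≡ (k + 1) * (k + 2) * (k + 3) * (7 * k * k + 28 * k + 20)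
  rowDistSquares-closed zero    = refl
  rowDistSquares-closed (suc k) = begin
    60 * rowDistSquares (3 + k)                   ≡⟨ cong (60 *_) (rowDistSquares-step (2 + k)) ⟩
    60 * (Q + 2 * W + P + R * R)                  ≡⟨ regroup Q W P R ⟩
    60 * Q + 20 * (6 * W) + 10 * (6 * P) + 15 * ((2 * R) * (2 * R))
      ≡⟨ cong₂ _+_ (cong₂ _+_ (cong₂ (λ x y → x + 20 * y) (rowDistSquares-closed k) (weightedRowDist-closed (suc k)))
                              (cong (10 *_) (squarePyramidal-closed (2 + k))))
                   (cong (λ x → 15 * (x * x)) (triangular-closed (2 + k))) ⟩
    (k + 1) * (k + 2) * (k + 3) * (7 * k * k + 28 * k + 20) + 20 * (suc k * suc (suc k) * (suc k + 2) * (suc k + 2))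
      + 10 * ((2 + k) * (3 + k) * (2 * (2 + k) + 1)) + 15 * (((2 + k) * (3 + k)) * ((2 + k) * (3 + k)))
      ≡⟨ poly k ⟩
    (suc k + 1) * (suc k + 2) * (suc k + 3) * (7 * suc k * suc k + 28 * suc k + 20) ∎
    where
    Q = rowDistSquares (2 + k)
    W = weightedRowDist (2 + k)
    P = squarePyramidal (2 + k)
    R = triangular (2 + k)
    regroup : ∀ Q W P R → 60 * (Q + 2 * W + P + R * R) ≡ 60 * Q + 20 * (6 * W) + 10 * (6 * P) + 15 * ((2 * R) * (2 * R))
    regroup = solve-∀
    poly : ∀ k → (k + 1) * (k + 2) * (k + 3) * (7 * k * k + 28 * k + 20) + 20 * (suc k * suc (suc k) * (suc k + 2) * (suc k + 2))
                   + 10 * ((2 + k) * (3 + k) * (2 * (2 + k) + 1)) + 15 * (((2 + k) * (3 + k)) * ((2 + k) * (3 + k)))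
               ≡ (suc k + 1) * (suc k + 2) * (suc k + 3) * (7 * suc k * suc k + 28 * suc k + 20)
    poly = solve-∀

module KernelSums where

  open FiniteSums
  open import Data.Nat using (ℕ; _+_; _*_)
  open import Data.Nat.Properties
  open import Data.Nat.Tactic.RingSolver using (solve-∀)
  open import Data.Fin using (Fin)
  open import Data.List using (allFin)
  open import Relation.Binary.PropositionalEquality
  open ≡-Reasoning

  module _ {n : ℕ} where

    coincidences : Fin n → Fin n → Fin n → Fin n → ℕ
    coincidences a b c d = 𝟙 (a == c) + 𝟙 (a == d) + 𝟙 (b == c) + 𝟙 (b == d)

    doubleCoincidences : Fin n → Fin n → Fin n → Fin n → ℕ
    doubleCoincidences a b c d = 𝟙 (a == c) * 𝟙 (b == d) + 𝟙 (a == d) * 𝟙 (b == c)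

  module SymmetricKernel {n : ℕ} (w : Fin n → Fin n → ℕ) (w-sym : ∀ a b → w a b ≡ w b a) where

    row : Fin n → ℕ
    row a = ∑ (allFin n) (w a)

    ∑²-w*row : ∑² (λ a b → w a b * row a) ≡ ∑ (allFin n) (λ a → row a * row a)
    ∑²-w*row = ∑-cong (allFin n) (λ a → ∑-*ʳ (allFin n) (row a) (w a))

    ∑²-w*row′ : ∑² (λ a b → w a b * row b) ≡ ∑ (allFin n) (λ a → row a * row a)
    ∑²-w*row′ = trans (∑²-comm (λ a b → w a b * row b)) (trans (∑²-cong (λ b a → cong (_* row b) (w-sym a b))) ∑²-w*row)

    weight : Fin n → Fin n → Fin n → Fin n → ℕ
    weight a b c d = w a b * w c d

    private
      ∑-w*w : ∀ a b → ∑ (allFin n) (λ d → w a b * w a d) ≡ w a b * row a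
      ∑-w*w a b = ∑-*ˡ (allFin n) (w a b) (w a)

    ∑⁴-δac : ∑⁴ (λ a b c d → 𝟙 (a == c) * weight a b c d) ≡ ∑ (allFin n) (λ a → row a * row a)
    ∑⁴-δac = trans (∑²-cong (λ a b → trans (∑²-δˡ a (weight a b)) (∑-w*w a b))) ∑²-w*row

    ∑⁴-δad : ∑⁴ (λ a b c d → 𝟙 (a == d) * weight a b c d) ≡ ∑ (allFin n) (λ a → row a * row a)
    ∑⁴-δad = trans (∑²-cong (λ a b → trans (∑²-δʳ a (weight a b))
                                     (trans (∑-cong (allFin n) (λ c → cong (w a b *_) (w-sym c a))) (∑-w*w a b))))
                   ∑²-w*row

    ∑⁴-δbc : ∑⁴ (λ a b c d → 𝟙 (b == c) * weight a b c d) ≡ ∑ (allFin n) (λ a → row a * row a)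
    ∑⁴-δbc = trans (∑²-cong (λ a b → trans (∑²-δˡ b (weight a b)) (∑-*ˡ (allFin n) (w a b) (w b)))) ∑²-w*row′

    ∑⁴-δbd : ∑⁴ (λ a b c d → 𝟙 (b == d) * weight a b c d) ≡ ∑ (allFin n) (λ a → row a * row a)
    ∑⁴-δbd = trans (∑²-cong (λ a b → trans (∑²-δʳ b (weight a b))
                                     (trans (∑-cong (allFin n) (λ c → cong (w a b *_) (w-sym c b)))
                                            (∑-*ˡ (allFin n) (w a b) (w b)))))
                   ∑²-w*row′

    ∑⁴-δac-δbd : ∑⁴ (λ a b c d → 𝟙 (a == c) * 𝟙 (b == d) * weight a b c d) ≡ ∑² (λ a b → w a b * w a b)
    ∑⁴-δac-δbd = ∑²-cong (λ a b →
      trans (∑²-cong (λ c d → *-assoc (𝟙 (a == c)) (𝟙 (b == d)) (weight a b c d)))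
            (trans (∑²-δˡ a (λ c d → 𝟙 (b == d) * weight a b c d)) (∑-δˡ n b (λ d → w a b * w a d))))

    ∑⁴-δad-δbc : ∑⁴ (λ a b c d → 𝟙 (a == d) * 𝟙 (b == c) * weight a b c d) ≡ ∑² (λ a b → w a b * w a b)
    ∑⁴-δad-δbc = ∑²-cong (λ a b →
      trans (∑²-cong (λ c d → *-comm-assoc (𝟙 (a == d)) (𝟙 (b == c)) (weight a b c d)))
            (trans (∑²-δˡ b (λ c d → 𝟙 (a == d) * weight a b c d))
                   (trans (∑-δˡ n a (λ d → w a b * w b d)) (cong (w a b *_) (w-sym b a)))))
      where
      *-comm-assoc : ∀ x y z → x * y * z ≡ y * (x * z)
      *-comm-assoc = solve-∀

    ∑⁴-coincidences : ∑⁴ (λ a b c d → coincidences a b c d * weight a b c d) ≡ 4 * ∑ (allFin n) (λ a → row a * row a)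
    ∑⁴-coincidences = begin
      ∑⁴ (λ a b c d → coincidences a b c d * weight a b c d)
        ≡⟨ ∑⁴-cong (λ a b c d → distrib (𝟙 (a == c)) (𝟙 (a == d)) (𝟙 (b == c)) (𝟙 (b == d)) (weight a b c d)) ⟩
      ∑⁴ (λ a b c d → Fac a b c d + Fad a b c d + Fbc a b c d + Fbd a b c d)
        ≡⟨ trans (∑⁴-distrib-+ (λ a b c d → Fac a b c d + Fad a b c d + Fbc a b c d) Fbd)
                 (cong (_+ ∑⁴ Fbd) (trans (∑⁴-distrib-+ (λ a b c d → Fac a b c d + Fad a b c d) Fbc)
                                          (cong (_+ ∑⁴ Fbc) (∑⁴-distrib-+ Fac Fad)))) ⟩
      ∑⁴ Fac + ∑⁴ Fad + ∑⁴ Fbc + ∑⁴ Fbd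
        ≡⟨ cong₂ _+_ (cong₂ _+_ (cong₂ _+_ ∑⁴-δac ∑⁴-δad) ∑⁴-δbc) ∑⁴-δbd ⟩
      S + S + S + S ≡⟨ four S ⟩
      4 * S ∎
      where
      S = ∑ (allFin n) (λ a → row a * row a)
      Fac Fad Fbc Fbd : Fin n → Fin n → Fin n → Fin n → ℕ
      Fac a b c d = 𝟙 (a == c) * weight a b c d
      Fad a b c d = 𝟙 (a == d) * weight a b c d
      Fbc a b c d = 𝟙 (b == c) * weight a b c d
      Fbd a b c d = 𝟙 (b == d) * weight a b c d
      distrib : ∀ p q r s x → (p + q + r + s) * x ≡ p * x + q * x + r * x + s * x
      distrib = solve-∀
      four : ∀ S → S + S + S + S ≡ 4 * S
      four = solve-∀

    ∑⁴-doubleCoincidences : ∑⁴ (λ a b c d → doubleCoincidences a b c d * weight a b c d) ≡ 2 * ∑² (λ a b → w a b * w a b)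
    ∑⁴-doubleCoincidences = begin
      ∑⁴ (λ a b c d → doubleCoincidences a b c d * weight a b c d)
        ≡⟨ ∑⁴-cong (λ a b c d → *-distribʳ-+ (weight a b c d) (𝟙 (a == c) * 𝟙 (b == d)) (𝟙 (a == d) * 𝟙 (b == c))) ⟩
      ∑⁴ (λ a b c d → Fac-bd a b c d + Fad-bc a b c d)
        ≡⟨ ∑⁴-distrib-+ Fac-bd Fad-bc ⟩
      ∑⁴ Fac-bd + ∑⁴ Fad-bc
        ≡⟨ cong₂ _+_ ∑⁴-δac-δbd ∑⁴-δad-δbc ⟩
      S + S ≡⟨ cong (S +_) (+-identityʳ S) ⟨
      2 * S ∎
      where
      S = ∑² (λ a b → w a b * w a b)
      Fac-bd Fad-bc : Fin n → Fin n → Fin n → Fin n → ℕ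
      Fac-bd a b c d = 𝟙 (a == c) * 𝟙 (b == d) * weight a b c d
      Fad-bc a b c d = 𝟙 (a == d) * 𝟙 (b == c) * weight a b c d

module ArrangementMoments where

  open FiniteSums
  open InjectiveVectors
  open KernelSums
  open DistanceSums
  open import Defs using (allVecs; arrangements)
  open import Data.Bool using (true; false; _∧_; _∨_; not)
  open import Data.Nat using (ℕ; zero; suc; _+_; _*_; _∸_; _!; ∣_-_∣)
  open import Data.Nat.Properties
  open import Data.Nat.Tactic.RingSolver using (solve-∀)
  open import Algebra.Properties.CommutativeSemigroup *-commutativeSemigroup using (x∙yz≈y∙xz)
  open import Data.Fin as Fin using (Fin; toℕ)
  open import Data.Vec as Vec using (Vec; []; _∷_; lookup; toList)
  open import Data.List using ([]; _∷_; allFin)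
  open import Data.Product using (_,_)
  open import Data.Empty using (⊥-elim)
  open import Relation.Nullary using (¬_; Dec; yes; no; does)
  open import Relation.Binary.PropositionalEquality
  open ≡-Reasoning

  module _ {n : ℕ} where

    dist : Fin n → Fin n → ℕ
    dist a b = ∣ toℕ a - toℕ b ∣

    dist-sym : ∀ a b → dist a b ≡ dist b a
    dist-sym a b = ∣-∣-comm (toℕ a) (toℕ b)

    dist-self : ∀ a → dist a a ≡ 0
    dist-self a = ∣n-n∣≡0 (toℕ a)

    edgeLength : Vec (Fin n) n → Fin n → Fin n → ℕ
    edgeLength π i j = dist (lookup π i) (lookup π j)

  ∑-allFin-toℕ : ∀ n (f : ℕ → ℕ) → ∑ (allFin n) (λ x → f (toℕ x)) ≡ ∑< n f
  ∑-allFin-toℕ zero    f = refl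
  ∑-allFin-toℕ (suc n) f = trans (∑-allFin-suc n (λ x → f (toℕ x))) (cong (f 0 +_) (∑-allFin-toℕ n (λ a → f (suc a))))

  module _ {n : ℕ} where

    open SymmetricKernel (dist {n}) dist-sym
      using ()
      renaming (row to rowDistᶠ; weight to distProduct;
                ∑⁴-coincidences to ∑⁴-coincidences-dist; ∑⁴-doubleCoincidences to ∑⁴-doubleCoincidences-dist)

    rowDistᶠ≡rowDist : ∀ (a : Fin n) → rowDistᶠ a ≡ rowDist n (toℕ a)
    rowDistᶠ≡rowDist a = ∑-allFin-toℕ n (λ b → ∣ toℕ a - b ∣)

    ∑²-dist : ∑² (dist {n}) ≡ totalDist n
    ∑²-dist = trans (∑-cong (allFin n) rowDistᶠ≡rowDist) (∑-allFin-toℕ n (rowDist n))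

    ∑²-dist² : ∑² (λ a b → dist {n} a b * dist a b) ≡ totalSqDist n
    ∑²-dist² = trans (∑-cong (allFin n) (λ a → ∑-allFin-toℕ n (λ b → ∣ toℕ a - b ∣ * ∣ toℕ a - b ∣)))
                     (∑-allFin-toℕ n (rowSqDist n))

    ∑-rowDistᶠ² : ∑ (allFin n) (λ (a : Fin n) → rowDistᶠ a * rowDistᶠ a) ≡ rowDistSquares n
    ∑-rowDistᶠ² = trans (∑-cong (allFin n) (λ a → cong (λ r → r * r) (rowDistᶠ≡rowDist a)))
                        (∑-allFin-toℕ n (λ a → rowDist n a * rowDist n a))

    ∑-allVecs-∷ : ∀ k (f : Vec (Fin n) (suc k) → ℕ) →
                  ∑ (allVecs n (suc k)) f ≡ ∑ (allFin n) (λ x → ∑ (allVecs n k) (λ w → f (x ∷ w)))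
    ∑-allVecs-∷ k f = trans (∑-allVecs-suc k f) (∑-comm (allVecs n k) (allFin n) (λ w x → f (x ∷ w)))

    ∑-allVecs-2 : ∀ (f : Vec (Fin n) 2 → ℕ) → ∑ (allVecs n 2) f ≡ ∑² (λ a b → f (a ∷ b ∷ []))
    ∑-allVecs-2 f = trans (∑-allVecs-∷ 1 f) (∑-cong (allFin n) λ a →
      trans (∑-allVecs-∷ 0 (λ w → f (a ∷ w))) (∑-cong (allFin n) (λ b → +-identityʳ (f (a ∷ b ∷ [])))))

    ∑-allVecs-3 : ∀ (f : Vec (Fin n) 3 → ℕ) → ∑ (allVecs n 3) f ≡ ∑³ (λ a b c → f (a ∷ b ∷ c ∷ []))
    ∑-allVecs-3 f = trans (∑-allVecs-∷ 2 f) (∑-cong (allFin n) (λ a → ∑-allVecs-2 (λ w → f (a ∷ w))))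

    ∑-allVecs-4 : ∀ (f : Vec (Fin n) 4 → ℕ) → ∑ (allVecs n 4) f ≡ ∑⁴ (λ a b c d → f (a ∷ b ∷ c ∷ d ∷ []))
    ∑-allVecs-4 f = trans (∑-allVecs-∷ 3 f) (∑-cong (allFin n) (λ a → ∑-allVecs-3 (λ w → f (a ∷ w))))

    ∑distinct : ∀ k → (Vec (Fin n) k → ℕ) → ℕ
    ∑distinct k g = ∑ (allVecs n k) (λ v → 𝟙 (distinct (toList v)) * g v)

    pairDist pairSqDist : Vec (Fin n) 2 → ℕ
    pairDist   (a ∷ b ∷ []) = dist a b
    pairSqDist (a ∷ b ∷ []) = dist a b * dist a b

    pathDist : Vec (Fin n) 3 → ℕ
    pathDist (a ∷ b ∷ c ∷ []) = dist a b * dist a c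

    matchingDist : Vec (Fin n) 4 → ℕ
    matchingDist (a ∷ b ∷ c ∷ d ∷ []) = dist a b * dist c d

    𝟙-distinct₂ : ∀ (a b : Fin n) x → 𝟙 (distinct (a ∷ b ∷ [])) * (dist a b * x) ≡ dist a b * x
    𝟙-distinct₂ a b x with a Fin.≟ b
    ... | yes refl rewrite dist-self a = refl
    ... | no _     = +-identityʳ (dist a b * x)

    ∑distinct-pairDist : ∑distinct 2 pairDist ≡ totalDist n
    ∑distinct-pairDist = trans (∑-allVecs-2 _) (trans (∑²-cong {n} λ a b →
      trans (cong (𝟙 (distinct (a ∷ b ∷ [])) *_) (sym (*-identityʳ (dist a b))))
            (trans (𝟙-distinct₂ a b 1) (*-identityʳ (dist a b)))) ∑²-dist)

    ∑distinct-pairSqDist : ∑distinct 2 pairSqDist ≡ totalSqDist n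
    ∑distinct-pairSqDist = trans (∑-allVecs-2 _) (trans (∑²-cong {n} (λ a b → 𝟙-distinct₂ a b (dist a b))) ∑²-dist²)

    -- The equality tests inside `distinct` are taken as Dec arguments, with `distinct` unfolded in the
    -- statement, so that the cases can be split with coinciding points substituted.
    path-overlaps : ∀ {a b c : Fin n} (ab : Dec (a ≡ b)) (ac : Dec (a ≡ c)) (bc : Dec (b ≡ c)) →
      𝟙 (not (does ab ∨ (does ac ∨ false)) ∧ (not (does bc ∨ false) ∧ true)) * (dist a b * dist a c)
        + 𝟙 (does bc) * (dist a b * dist a c) ≡ dist a b * dist a c
    path-overlaps {a} {b} {c} (yes refl) _ bc rewrite dist-self a = *-zeroʳ (𝟙 (does bc))
    path-overlaps {a} {b} {c} (no _) (yes refl) bc rewrite dist-self a | *-zeroʳ (dist a b) =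
      *-zeroʳ (𝟙 (does bc))
    path-overlaps (no _) (no _) (yes _) = +-identityʳ _
    path-overlaps (no _) (no _) (no _)  = trans (+-identityʳ _) (+-identityʳ _)

    ∑distinct-pathDist : ∑distinct 3 pathDist + totalSqDist n ≡ rowDistSquares n
    ∑distinct-pathDist = begin
      ∑distinct 3 pathDist + totalSqDist n
        ≡⟨ cong₂ _+_ (∑-allVecs-3 (λ v → 𝟙 (distinct (toList v)) * pathDist v)) (sym collapse) ⟩
      ∑³ {n} (λ a b c → 𝟙 (distinct (a ∷ b ∷ c ∷ [])) * (dist a b * dist a c)) + ∑³ {n} (λ a b c → 𝟙 (b == c) * (dist a b * dist a c))
        ≡⟨ ∑³-distrib-+ {n} (λ a b c → 𝟙 (distinct (a ∷ b ∷ c ∷ [])) * (dist a b * dist a c))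
                        (λ a b c → 𝟙 (b == c) * (dist a b * dist a c)) ⟨
      ∑³ {n} (λ a b c → 𝟙 (distinct (a ∷ b ∷ c ∷ [])) * (dist a b * dist a c) + 𝟙 (b == c) * (dist a b * dist a c))
        ≡⟨ ∑³-cong {n} (λ a b c → path-overlaps (a Fin.≟ b) (a Fin.≟ c) (b Fin.≟ c)) ⟩
      ∑³ {n} (λ a b c → dist a b * dist a c)
        ≡⟨ ∑-cong (allFin n) (λ a → trans (∑-cong (allFin n) (λ b → ∑-*ˡ (allFin n) (dist a b) (dist a)))
                                          (∑-*ʳ (allFin n) (rowDistᶠ a) (dist a))) ⟩
      ∑ (allFin n) (λ a → rowDistᶠ a * rowDistᶠ a)
        ≡⟨ ∑-rowDistᶠ² ⟩
      rowDistSquares n ∎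
      where
      collapse : ∑³ (λ (a b c : Fin n) → 𝟙 (b == c) * (dist a b * dist a c)) ≡ totalSqDist n
      collapse = trans (∑²-cong (λ a b → ∑-δˡ n b (λ c → dist a b * dist a c))) ∑²-dist²

    vanishing : ∀ {F Z D E : ℕ} → F ≡ 0 → F + Z * F ≡ D * F + E * F
    vanishing {Z = Z} {D} {E} refl = trans (*-zeroʳ Z) (sym (cong₂ _+_ (*-zeroʳ D) (*-zeroʳ E)))

    matching-overlaps : ∀ {a b c d : Fin n} → ¬ a ≡ b → ¬ c ≡ d →
      (ab : Dec (a ≡ b)) (ac : Dec (a ≡ c)) (ad : Dec (a ≡ d)) (bc : Dec (b ≡ c)) (bd : Dec (b ≡ d)) (cd : Dec (c ≡ d)) →
      1 + (𝟙 (does ac) * 𝟙 (does bd) + 𝟙 (does ad) * 𝟙 (does bc))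
        ≡ 𝟙 (not (does ab ∨ (does ac ∨ (does ad ∨ false))) ∧ (not (does bc ∨ (does bd ∨ false)) ∧ (not (does cd ∨ false) ∧ true)))
          + (𝟙 (does ac) + 𝟙 (does ad) + 𝟙 (does bc) + 𝟙 (does bd))
    matching-overlaps a≢b c≢d (yes a≡b) _ _ _ _ _ = ⊥-elim (a≢b a≡b)
    matching-overlaps a≢b c≢d _ _ _ _ _ (yes c≡d) = ⊥-elim (c≢d c≡d)
    matching-overlaps a≢b c≢d (no _) (yes refl) (yes refl) _ _ (no _) = ⊥-elim (c≢d refl)
    matching-overlaps a≢b c≢d (no _) (yes refl) _ (yes refl) _ (no _) = ⊥-elim (a≢b refl)
    matching-overlaps a≢b c≢d (no _) _ (yes refl) _ (yes refl) (no _) = ⊥-elim (a≢b refl)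
    matching-overlaps a≢b c≢d (no _) _ _ (yes refl) (yes refl) (no _) = ⊥-elim (c≢d refl)
    matching-overlaps _ _ (no _) (yes _) (no _) (no _) (yes _) (no _) = refl
    matching-overlaps _ _ (no _) (yes _) (no _) (no _) (no _)  (no _) = refl
    matching-overlaps _ _ (no _) (no _)  (yes _) (yes _) (no _) (no _) = refl
    matching-overlaps _ _ (no _) (no _)  (yes _) (no _) (no _)  (no _) = refl
    matching-overlaps _ _ (no _) (no _)  (no _) (yes _) (no _)  (no _) = refl
    matching-overlaps _ _ (no _) (no _)  (no _) (no _)  (yes _) (no _) = refl
    matching-overlaps _ _ (no _) (no _)  (no _) (no _)  (no _)  (no _) = refl

    matching-pointwise : ∀ {a b c d : Fin n} → Dec (a ≡ b) → Dec (c ≡ d) →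
      distProduct a b c d + doubleCoincidences a b c d * distProduct a b c d
        ≡ 𝟙 (distinct (a ∷ b ∷ c ∷ d ∷ [])) * distProduct a b c d + coincidences a b c d * distProduct a b c d
    matching-pointwise {a} {b} {c} {d} (yes refl) _ =
      vanishing {Z = doubleCoincidences a a c d} {𝟙 (distinct (a ∷ a ∷ c ∷ d ∷ []))} {coincidences a a c d}
                (cong (_* dist c d) (dist-self a))
    matching-pointwise {a} {b} {c} {d} (no _) (yes refl) =
      vanishing {Z = doubleCoincidences a b c c} {𝟙 (distinct (a ∷ b ∷ c ∷ c ∷ []))} {coincidences a b c c}
                (trans (cong (dist a b *_) (dist-self c)) (*-zeroʳ (dist a b)))
    matching-pointwise {a} {b} {c} {d} (no a≢b) (no c≢d) = begin
      F + Z * F       ≡⟨ factor F Z ⟩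
      (1 + Z) * F     ≡⟨ cong (_* F) (matching-overlaps {a} {b} {c} {d} a≢b c≢d (a Fin.≟ b) (a Fin.≟ c) (a Fin.≟ d) (b Fin.≟ c) (b Fin.≟ d) (c Fin.≟ d)) ⟩
      (𝟙 (distinct (a ∷ b ∷ c ∷ d ∷ [])) + E) * F ≡⟨ *-distribʳ-+ F (𝟙 (distinct (a ∷ b ∷ c ∷ d ∷ []))) E ⟩
      𝟙 (distinct (a ∷ b ∷ c ∷ d ∷ [])) * F + E * F ∎
      where
      F = distProduct a b c d
      Z = doubleCoincidences a b c d
      E = coincidences a b c d
      factor : ∀ F Z → F + Z * F ≡ (1 + Z) * F
      factor = solve-∀

    ∑distinct-matchingDist : totalDist n * totalDist n + 2 * totalSqDist n ≡ ∑distinct 4 matchingDist + 4 * rowDistSquares n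
    ∑distinct-matchingDist = begin
      totalDist n * totalDist n + 2 * totalSqDist n
        ≡⟨ cong₂ _+_ (trans (sym (cong₂ _*_ ∑²-dist ∑²-dist)) (∑²-product {n} dist dist))
                     (trans (cong (2 *_) (sym ∑²-dist²)) (sym ∑⁴-doubleCoincidences-dist)) ⟩
      ∑⁴ {n} distProduct + ∑⁴ {n} (λ a b c d → doubleCoincidences a b c d * distProduct a b c d)
        ≡⟨ ∑⁴-distrib-+ distProduct (λ a b c d → doubleCoincidences a b c d * distProduct a b c d) ⟨
      ∑⁴ {n} (λ a b c d → distProduct a b c d + doubleCoincidences a b c d * distProduct a b c d)
        ≡⟨ ∑⁴-cong (λ a b c d → matching-pointwise (a Fin.≟ b) (c Fin.≟ d)) ⟩
      ∑⁴ {n} (λ a b c d → 𝟙 (distinct (a ∷ b ∷ c ∷ d ∷ [])) * distProduct a b c d + coincidences a b c d * distProduct a b c d)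
        ≡⟨ ∑⁴-distrib-+ (λ a b c d → 𝟙 (distinct (a ∷ b ∷ c ∷ d ∷ [])) * distProduct a b c d)
                        (λ a b c d → coincidences a b c d * distProduct a b c d) ⟩
      ∑⁴ {n} (λ a b c d → 𝟙 (distinct (a ∷ b ∷ c ∷ d ∷ [])) * distProduct a b c d)
        + ∑⁴ {n} (λ a b c d → coincidences a b c d * distProduct a b c d)
        ≡⟨ cong₂ _+_ (sym (∑-allVecs-4 _)) (trans ∑⁴-coincidences-dist (cong (4 *_) ∑-rowDistᶠ²)) ⟩
      ∑distinct 4 matchingDist + 4 * rowDistSquares n ∎

  ∑distinct-pathDist-closed : ∀ m → 60 * ∑distinct {3 + m} 3 pathDist ≡ (m + 1) * (m + 2) * (m + 3) * (m + 4) * (7 * m + 25)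
  ∑distinct-pathDist-closed m = +-cancelˡ-≡ (10 * (6 * B)) _ _ (begin
    10 * (6 * B) + 60 * I₃       ≡⟨ regroup B I₃ ⟩
    60 * (I₃ + B)                ≡⟨ cong (60 *_) (∑distinct-pathDist {3 + m}) ⟩
    60 * rowDistSquares (3 + m)  ≡⟨ rowDistSquares-closed (suc m) ⟩
    (suc m + 1) * (suc m + 2) * (suc m + 3) * (7 * suc m * suc m + 28 * suc m + 20)
      ≡⟨ poly m ⟩
    10 * ((2 + m) * (3 + m) * (3 + m) * (2 + m + 2)) + (m + 1) * (m + 2) * (m + 3) * (m + 4) * (7 * m + 25)
      ≡⟨ cong (λ x → 10 * x + (m + 1) * (m + 2) * (m + 3) * (m + 4) * (7 * m + 25)) (totalSqDist-closed (2 + m)) ⟨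
    10 * (6 * B) + (m + 1) * (m + 2) * (m + 3) * (m + 4) * (7 * m + 25) ∎)
    where
    B = totalSqDist (3 + m)
    I₃ = ∑distinct {3 + m} 3 pathDist
    regroup : ∀ B I → 10 * (6 * B) + 60 * I ≡ 60 * (I + B)
    regroup = solve-∀
    poly : ∀ m → (suc m + 1) * (suc m + 2) * (suc m + 3) * (7 * suc m * suc m + 28 * suc m + 20)
               ≡ 10 * ((2 + m) * (3 + m) * (3 + m) * (2 + m + 2)) + (m + 1) * (m + 2) * (m + 3) * (m + 4) * (7 * m + 25)
    poly = solve-∀

  ∑distinct-matchingDist-closed : ∀ m →
    45 * ∑distinct {4 + m} 4 matchingDist ≡ (m + 1) * (m + 2) * (m + 3) * (m + 4) * (m + 5) * (5 * m + 24)
  ∑distinct-matchingDist-closed m = *-cancelˡ-≡ _ _ 4 (+-cancelʳ-≡ (12 * Qᶜ) _ _ (begin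
    4 * (45 * I₄) + 12 * Qᶜ                ≡⟨ cong (λ x → 4 * (45 * I₄) + 12 * x) (rowDistSquares-closed (2 + m)) ⟨
    4 * (45 * I₄) + 12 * (60 * Q)          ≡⟨ regroup I₄ Q ⟩
    180 * (I₄ + 4 * Q)                     ≡⟨ cong (180 *_) (∑distinct-matchingDist {4 + m}) ⟨
    180 * (T * T + 2 * B)                  ≡⟨ regroup′ T B ⟩
    20 * ((3 * T) * (3 * T)) + 60 * (6 * B)
      ≡⟨ cong₂ (λ x y → 20 * (x * x) + 60 * y) (totalDist-closed (3 + m)) (totalSqDist-closed (3 + m)) ⟩
    20 * (((3 + m) * suc (3 + m) * (3 + m + 2)) * ((3 + m) * suc (3 + m) * (3 + m + 2)))
      + 60 * ((3 + m) * suc (3 + m) * suc (3 + m) * (3 + m + 2))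
      ≡⟨ poly m ⟩
    4 * ((m + 1) * (m + 2) * (m + 3) * (m + 4) * (m + 5) * (5 * m + 24)) + 12 * Qᶜ ∎))
    where
    T = totalDist (4 + m)
    B = totalSqDist (4 + m)
    Q = rowDistSquares (4 + m)
    I₄ = ∑distinct {4 + m} 4 matchingDist
    Qᶜ = (2 + m + 1) * (2 + m + 2) * (2 + m + 3) * (7 * (2 + m) * (2 + m) + 28 * (2 + m) + 20)
    regroup : ∀ I Q → 4 * (45 * I) + 12 * (60 * Q) ≡ 180 * (I + 4 * Q)
    regroup = solve-∀
    regroup′ : ∀ T B → 180 * (T * T + 2 * B) ≡ 20 * ((3 * T) * (3 * T)) + 60 * (6 * B)
    regroup′ = solve-∀
    poly : ∀ m → 20 * (((3 + m) * suc (3 + m) * (3 + m + 2)) * ((3 + m) * suc (3 + m) * (3 + m + 2)))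
                   + 60 * ((3 + m) * suc (3 + m) * suc (3 + m) * (3 + m + 2))
               ≡ 4 * ((m + 1) * (m + 2) * (m + 3) * (m + 4) * (m + 5) * (5 * m + 24))
                   + 12 * ((2 + m + 1) * (2 + m + 2) * (2 + m + 3) * (7 * (2 + m) * (2 + m) + 28 * (2 + m) + 20))
    poly = solve-∀

  ∑-arrangements-restrict-scaled : ∀ {n k} c (us : Vec (Fin n) k) → distinct (toList us) ≡ true → (g : Vec (Fin n) k → ℕ) →
    c * ∑ (arrangements n) (λ π → g (Vec.map (lookup π) us)) ≡ (n ∸ k) ! * (c * ∑distinct k g)
  ∑-arrangements-restrict-scaled {n} {k} c us dus g =
    trans (cong (c *_) (∑-arrangements-restrict us dus g)) (x∙yz≈y∙xz c ((n ∸ k) !) (∑distinct k g))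

  moment-pair : ∀ {n} {i j : Fin n} → ¬ i ≡ j →
    3 * ∑ (arrangements n) (λ π → edgeLength π i j) ≡ n ! * (n + 1)
  moment-pair {n} {i} {j} i≢j
    with m , refl ← m≤n⇒∃[o]m+o≡n (distinct⇒≤ (i ∷ j ∷ []) (distinct₂ i≢j)) = begin
    3 * ∑ (arrangements (2 + m)) (λ π → pairDist (Vec.map (lookup π) (i ∷ j ∷ [])))
      ≡⟨ ∑-arrangements-restrict-scaled 3 (i ∷ j ∷ []) (distinct₂ i≢j) pairDist ⟩
    m ! * (3 * ∑distinct {2 + m} 2 pairDist)             ≡⟨ cong (λ x → m ! * (3 * x)) (∑distinct-pairDist {2 + m}) ⟩
    m ! * (3 * totalDist (2 + m))                ≡⟨ cong (m ! *_) (totalDist-closed (1 + m)) ⟩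
    m ! * ((1 + m) * suc (1 + m) * (1 + m + 2))  ≡⟨ poly (m !) m ⟩
    (2 + m) * ((1 + m) * m !) * (2 + m + 1)      ∎
    where
    poly : ∀ f m → f * ((1 + m) * suc (1 + m) * (1 + m + 2)) ≡ (2 + m) * ((1 + m) * f) * (2 + m + 1)
    poly = solve-∀

  moment-pair² : ∀ {n} {i j : Fin n} → ¬ i ≡ j →
    6 * ∑ (arrangements n) (λ π → edgeLength π i j * edgeLength π i j) ≡ n ! * (n * (n + 1))
  moment-pair² {n} {i} {j} i≢j
    with m , refl ← m≤n⇒∃[o]m+o≡n (distinct⇒≤ (i ∷ j ∷ []) (distinct₂ i≢j)) = begin
    6 * ∑ (arrangements (2 + m)) (λ π → pairSqDist (Vec.map (lookup π) (i ∷ j ∷ [])))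
      ≡⟨ ∑-arrangements-restrict-scaled 6 (i ∷ j ∷ []) (distinct₂ i≢j) pairSqDist ⟩
    m ! * (6 * ∑distinct {2 + m} 2 pairSqDist)                  ≡⟨ cong (λ x → m ! * (6 * x)) (∑distinct-pairSqDist {2 + m}) ⟩
    m ! * (6 * totalSqDist (2 + m))                     ≡⟨ cong (m ! *_) (totalSqDist-closed (1 + m)) ⟩
    m ! * ((1 + m) * suc (1 + m) * suc (1 + m) * (1 + m + 2)) ≡⟨ poly (m !) m ⟩
    (2 + m) * ((1 + m) * m !) * ((2 + m) * (2 + m + 1)) ∎
    where
    poly : ∀ f m → f * ((1 + m) * suc (1 + m) * suc (1 + m) * (1 + m + 2)) ≡ (2 + m) * ((1 + m) * f) * ((2 + m) * (2 + m + 1))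
    poly = solve-∀

  moment-path : ∀ {n} {i j l : Fin n} → ¬ i ≡ j → ¬ i ≡ l → ¬ j ≡ l →
    60 * ∑ (arrangements n) (λ π → edgeLength π i j * edgeLength π i l) ≡ n ! * ((n + 1) * (7 * n + 4))
  moment-path {n} {i} {j} {l} i≢j i≢l j≢l
    with m , refl ← m≤n⇒∃[o]m+o≡n (distinct⇒≤ (i ∷ j ∷ l ∷ []) (distinct₃ i≢j i≢l j≢l)) = begin
    60 * ∑ (arrangements (3 + m)) (λ π → pathDist (Vec.map (lookup π) (i ∷ j ∷ l ∷ [])))
      ≡⟨ ∑-arrangements-restrict-scaled 60 (i ∷ j ∷ l ∷ []) (distinct₃ i≢j i≢l j≢l) pathDist ⟩
    m ! * (60 * ∑distinct {3 + m} 3 pathDist)                        ≡⟨ cong (m ! *_) (∑distinct-pathDist-closed m) ⟩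
    m ! * ((m + 1) * (m + 2) * (m + 3) * (m + 4) * (7 * m + 25)) ≡⟨ poly (m !) m ⟩
    (3 + m) * ((2 + m) * ((1 + m) * m !)) * ((3 + m + 1) * (7 * (3 + m) + 4)) ∎
    where
    poly : ∀ f m → f * ((m + 1) * (m + 2) * (m + 3) * (m + 4) * (7 * m + 25))
                 ≡ (3 + m) * ((2 + m) * ((1 + m) * f)) * ((3 + m + 1) * (7 * (3 + m) + 4))
    poly = solve-∀

  moment-matching : ∀ {n} {i j k l : Fin n} → ¬ i ≡ j → ¬ i ≡ k → ¬ i ≡ l → ¬ j ≡ k → ¬ j ≡ l → ¬ k ≡ l →
    45 * ∑ (arrangements n) (λ π → edgeLength π i j * edgeLength π k l) ≡ n ! * ((n + 1) * (5 * n + 4))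
  moment-matching {n} {i} {j} {k} {l} i≢j i≢k i≢l j≢k j≢l k≢l
    with m , refl ← m≤n⇒∃[o]m+o≡n (distinct⇒≤ (i ∷ j ∷ k ∷ l ∷ []) (distinct₄ i≢j i≢k i≢l j≢k j≢l k≢l)) = begin
    45 * ∑ (arrangements (4 + m)) (λ π → matchingDist (Vec.map (lookup π) (i ∷ j ∷ k ∷ l ∷ [])))
      ≡⟨ ∑-arrangements-restrict-scaled 45 (i ∷ j ∷ k ∷ l ∷ []) distinct-ijkl matchingDist ⟩
    m ! * (45 * ∑distinct {4 + m} 4 matchingDist)                    ≡⟨ cong (m ! *_) (∑distinct-matchingDist-closed m) ⟩
    m ! * ((m + 1) * (m + 2) * (m + 3) * (m + 4) * (m + 5) * (5 * m + 24)) ≡⟨ poly (m !) m ⟩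
    (4 + m) * ((3 + m) * ((2 + m) * ((1 + m) * m !))) * ((4 + m + 1) * (5 * (4 + m) + 4)) ∎
    where
    distinct-ijkl = distinct₄ i≢j i≢k i≢l j≢k j≢l k≢l
    poly : ∀ f m → f * ((m + 1) * (m + 2) * (m + 3) * (m + 4) * (m + 5) * (5 * m + 24))
                 ≡ (4 + m) * ((3 + m) * ((2 + m) * ((1 + m) * f))) * ((4 + m + 1) * (5 * (4 + m) + 4))
    poly = solve-∀

module GraphSums where

  open FiniteSums
  open ArrangementMoments using (edgeLength; dist-sym)
  open import Defs renaming (sym to adj-sym)
  open import Data.Bool using (Bool; true; false; _∧_; T)
  open import Data.Bool.Properties using (∧-zeroʳ; ∧-identityʳ)
  open import Data.Nat using (ℕ; _+_; _*_; _<ᵇ_)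
  open import Data.Nat.Properties
  open import Data.Fin as Fin using (Fin; toℕ)
  import Data.Fin.Properties as Fin
  open import Data.Vec using (lookup)
  open import Data.List as List using (allFin; filterᵇ)
  open import Data.Product using (_×_; _,_; proj₁; proj₂)
  open import Data.Empty using (⊥-elim)
  open import Relation.Nullary using (¬_)
  open import Relation.Binary.Definitions using (tri<; tri≈; tri>)
  open import Relation.Binary.PropositionalEquality
  open ≡-Reasoning

  private
    T⇒≡true : ∀ {b} → T b → b ≡ true
    T⇒≡true {true} _ = refl

    ¬T⇒≡false : ∀ {b} → ¬ T b → b ≡ false
    ¬T⇒≡false {true}  ¬t = ⊥-elim (¬t _)
    ¬T⇒≡false {false} _  = refl

  module _ {n : ℕ} (G : SimpleGraph n) where

    adjacency : Fin n → Fin n → ℕ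
    adjacency i j = 𝟙 (adj G i j)

    adjacency-sym : ∀ i j → adjacency i j ≡ adjacency j i
    adjacency-sym i j = cong 𝟙 (adj-sym G i j)

    adj⇒≢ : ∀ {i j} → adj G i j ≡ true → ¬ i ≡ j
    adj⇒≢ {i} aᵢⱼ refl with () ← trans (sym aᵢⱼ) (irrefl G i)

    private
      before : Fin n → Fin n → Bool
      before i j = toℕ i <ᵇ toℕ j

    ∑-edges : ∀ (h : Fin n × Fin n → ℕ) →
              ∑ (edges G) h ≡ ∑² (λ i j → 𝟙 (before i j ∧ adj G i j) * h (i , j))
    ∑-edges h = begin
      ∑ (edges G) h
        ≡⟨ ∑-filterᵇ (λ p → before (proj₁ p) (proj₂ p) ∧ adj G (proj₁ p) (proj₂ p)) pairs h ⟩
      ∑ pairs (λ p → 𝟙 (before (proj₁ p) (proj₂ p) ∧ adj G (proj₁ p) (proj₂ p)) * h p)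
        ≡⟨ ∑-concatMap (λ i → List.map (i ,_) (allFin n)) (allFin n) _ ⟩
      ∑ (allFin n) (λ i → ∑ (List.map (i ,_) (allFin n)) (λ p → 𝟙 (before (proj₁ p) (proj₂ p) ∧ adj G (proj₁ p) (proj₂ p)) * h p))
        ≡⟨ ∑-cong (allFin n) (λ i → ∑-map (i ,_) (allFin n) _) ⟩
      ∑² (λ i j → 𝟙 (before i j ∧ adj G i j) * h (i , j)) ∎
      where
      pairs = List.concatMap (λ i → List.map (i ,_) (allFin n)) (allFin n)

    adjacency-split : ∀ i j → adjacency i j ≡ 𝟙 (before i j ∧ adj G i j) + 𝟙 (before j i ∧ adj G i j)
    adjacency-split i j with adj G i j in aᵢⱼ
    ... | false rewrite ∧-zeroʳ (before i j) | ∧-zeroʳ (before j i) = refl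
    ... | true rewrite ∧-identityʳ (before i j) | ∧-identityʳ (before j i) with <-cmp (toℕ i) (toℕ j)
    ... | tri< i<j _ j≮i rewrite T⇒≡true (<⇒<ᵇ i<j) | ¬T⇒≡false (λ t → j≮i (<ᵇ⇒< _ _ t)) = refl
    ... | tri> i≮j _ j<i rewrite T⇒≡true (<⇒<ᵇ j<i) | ¬T⇒≡false (λ t → i≮j (<ᵇ⇒< _ _ t)) = refl
    ... | tri≈ _ i≡j _ = ⊥-elim (adj⇒≢ aᵢⱼ (Fin.toℕ-injective i≡j))

    ∑-edges-symmetric : ∀ (f : Fin n → Fin n → ℕ) → (∀ i j → f i j ≡ f j i) →
                        2 * ∑ (edges G) (λ e → f (proj₁ e) (proj₂ e)) ≡ ∑² (λ i j → adjacency i j * f i j)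
    ∑-edges-symmetric f f-sym = begin
      2 * ∑ (edges G) (λ e → f (proj₁ e) (proj₂ e)) ≡⟨ cong (2 *_) (∑-edges (λ e → f (proj₁ e) (proj₂ e))) ⟩
      2 * forward                                   ≡⟨ cong (forward +_) (+-identityʳ forward) ⟩
      forward + forward                             ≡⟨ cong (forward +_) forward≡backward ⟩
      forward + backward                            ≡⟨ ∑²-distrib-+ {n} (λ i j → 𝟙 (before i j ∧ adj G i j) * f i j) (λ i j → 𝟙 (before j i ∧ adj G i j) * f i j) ⟨
      ∑² (λ i j → 𝟙 (before i j ∧ adj G i j) * f i j + 𝟙 (before j i ∧ adj G i j) * f i j)
        ≡⟨ ∑²-cong {n} (λ i j → trans (sym (*-distribʳ-+ (f i j) (𝟙 (before i j ∧ adj G i j)) (𝟙 (before j i ∧ adj G i j)))) (cong (_* f i j) (sym (adjacency-split i j)))) ⟩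
      ∑² (λ i j → adjacency i j * f i j)             ∎
      where
      forward = ∑² (λ i j → 𝟙 (before i j ∧ adj G i j) * f i j)
      backward = ∑² (λ i j → 𝟙 (before j i ∧ adj G i j) * f i j)
      forward≡backward : forward ≡ backward
      forward≡backward = trans (∑²-comm (λ i j → 𝟙 (before i j ∧ adj G i j) * f i j)) (∑²-cong (λ i j → cong₂ (λ b x → 𝟙 (before j i ∧ b) * x) (adj-sym G j i) (f-sym j i)))

    2*numEdges : 2 * numEdges G ≡ ∑² adjacency
    2*numEdges = trans (cong (2 *_) (sym (∑-one (edges G))))
                       (trans (∑-edges-symmetric (λ _ _ → 1) (λ _ _ → refl)) (∑²-cong (λ i j → *-identityʳ (adjacency i j))))

    degree≡∑adjacency : ∀ i → degree G i ≡ ∑ (allFin n) (adjacency i)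
    degree≡∑adjacency i = trans (sym (∑-one (filterᵇ (adj G i) (allFin n))))
                                (trans (∑-filterᵇ (adj G i) (allFin n) (λ _ → 1)) (∑-cong (allFin n) (λ j → *-identityʳ (adjacency i j))))

    sumSqDeg≡ : sumSqDeg G ≡ ∑ (allFin n) (λ i → ∑ (allFin n) (adjacency i) * ∑ (allFin n) (adjacency i))
    sumSqDeg≡ = ∑-cong (allFin n) (λ i → cong (λ k → k * k) (degree≡∑adjacency i))

    2*D : ∀ π → 2 * D G π ≡ ∑² (λ i j → adjacency i j * edgeLength π i j)
    2*D π = ∑-edges-symmetric (edgeLength π) (λ i j → dist-sym (lookup π i) (lookup π j))

module GraphMoments where

  open FiniteSums
  open KernelSums
  open ArrangementMoments
  open GraphSums
  open import Defs renaming (sym to adj-sym)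
  open import Data.Bool using (true; false)
  open import Data.Nat using (ℕ; _+_; _*_; _!)
  open import Data.Nat.Properties
  open import Data.Nat.Tactic.RingSolver using (solve-∀)
  open import Algebra.Properties.CommutativeSemigroup *-commutativeSemigroup using (x∙yz≈y∙xz)
  open import Data.Fin as Fin using (Fin)
  open import Data.Vec using (Vec; lookup)
  open import Data.Empty using (⊥-elim)
  open import Relation.Nullary using (¬_; Dec; yes; no; does)
  open import Relation.Binary.PropositionalEquality
  open ≡-Reasoning

  -- 180 times the expected product of the lengths of two edges sharing no, one or both endpoints.
  κ₀ κ₁ κ₂ : ℕ → ℕ
  κ₀ n = 4 * ((n + 1) * (5 * n + 4))
  κ₁ n = 3 * ((n + 1) * (7 * n + 4))
  κ₂ n = 30 * (n * (n + 1))

  module _ {n : ℕ} where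

    lengthProduct : Fin n → Fin n → Fin n → Fin n → ℕ
    lengthProduct i j k l = ∑ (arrangements n) (λ π → edgeLength π i j * edgeLength π k l)

    lengthProduct-swapˡ : ∀ i j k l → lengthProduct i j k l ≡ lengthProduct j i k l
    lengthProduct-swapˡ i j k l =
      ∑-cong (arrangements n) (λ π → cong (_* edgeLength π k l) (dist-sym (lookup π i) (lookup π j)))

    lengthProduct-swapʳ : ∀ i j k l → lengthProduct i j k l ≡ lengthProduct i j l k
    lengthProduct-swapʳ i j k l =
      ∑-cong (arrangements n) (λ π → cong (edgeLength π i j *_) (dist-sym (lookup π k) (lookup π l)))

    private
      via-matching : ∀ {P} → 45 * P ≡ n ! * ((n + 1) * (5 * n + 4)) →
        180 * P + n ! * (κ₀ n * 0 + 2 * κ₁ n * 0) ≡ n ! * (κ₀ n + κ₀ n * 0 + κ₁ n * 0 + κ₂ n * 0)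
      via-matching {P} h = trans (cong (_+ n ! * (κ₀ n * 0 + 2 * κ₁ n * 0)) (trans (scale P) (cong (4 *_) h))) (poly (n !) n)
        where
        scale : ∀ P → 180 * P ≡ 4 * (45 * P)
        scale = solve-∀
        poly : ∀ N n → 4 * (N * ((n + 1) * (5 * n + 4))) + N * (4 * ((n + 1) * (5 * n + 4)) * 0 + 2 * (3 * ((n + 1) * (7 * n + 4))) * 0)
                     ≡ N * (4 * ((n + 1) * (5 * n + 4)) + 4 * ((n + 1) * (5 * n + 4)) * 0 + 3 * ((n + 1) * (7 * n + 4)) * 0 + 30 * (n * (n + 1)) * 0)
        poly = solve-∀

      via-path : ∀ {P} → 60 * P ≡ n ! * ((n + 1) * (7 * n + 4)) →
        180 * P + n ! * (κ₀ n * 1 + 2 * κ₁ n * 0) ≡ n ! * (κ₀ n + κ₀ n * 0 + κ₁ n * 1 + κ₂ n * 0)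
      via-path {P} h = trans (cong (_+ n ! * (κ₀ n * 1 + 2 * κ₁ n * 0)) (trans (scale P) (cong (3 *_) h))) (poly (n !) n)
        where
        scale : ∀ P → 180 * P ≡ 3 * (60 * P)
        scale = solve-∀
        poly : ∀ N n → 3 * (N * ((n + 1) * (7 * n + 4))) + N * (4 * ((n + 1) * (5 * n + 4)) * 1 + 2 * (3 * ((n + 1) * (7 * n + 4))) * 0)
                     ≡ N * (4 * ((n + 1) * (5 * n + 4)) + 4 * ((n + 1) * (5 * n + 4)) * 0 + 3 * ((n + 1) * (7 * n + 4)) * 1 + 30 * (n * (n + 1)) * 0)
        poly = solve-∀

      via-pair : ∀ {P} → 6 * P ≡ n ! * (n * (n + 1)) →
        180 * P + n ! * (κ₀ n * 2 + 2 * κ₁ n * 1) ≡ n ! * (κ₀ n + κ₀ n * 1 + κ₁ n * 2 + κ₂ n * 1)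
      via-pair {P} h = trans (cong (_+ n ! * (κ₀ n * 2 + 2 * κ₁ n * 1)) (trans (scale P) (cong (30 *_) h))) (poly (n !) n)
        where
        scale : ∀ P → 180 * P ≡ 30 * (6 * P)
        scale = solve-∀
        poly : ∀ N n → 30 * (N * (n * (n + 1))) + N * (4 * ((n + 1) * (5 * n + 4)) * 2 + 2 * (3 * ((n + 1) * (7 * n + 4))) * 1)
                     ≡ N * (4 * ((n + 1) * (5 * n + 4)) + 4 * ((n + 1) * (5 * n + 4)) * 1 + 3 * ((n + 1) * (7 * n + 4)) * 2 + 30 * (n * (n + 1)) * 1)
        poly = solve-∀

    lengthProduct-moment : ∀ {i j k l : Fin n} → ¬ i ≡ j → ¬ k ≡ l →
      (ik : Dec (i ≡ k)) (il : Dec (i ≡ l)) (jk : Dec (j ≡ k)) (jl : Dec (j ≡ l)) →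
      180 * lengthProduct i j k l
        + n ! * (κ₀ n * (𝟙 (does ik) + 𝟙 (does il) + 𝟙 (does jk) + 𝟙 (does jl))
                 + 2 * κ₁ n * (𝟙 (does ik) * 𝟙 (does jl) + 𝟙 (does il) * 𝟙 (does jk)))
        ≡ n ! * (κ₀ n + κ₀ n * (𝟙 (does ik) * 𝟙 (does jl) + 𝟙 (does il) * 𝟙 (does jk))
                 + κ₁ n * (𝟙 (does ik) + 𝟙 (does il) + 𝟙 (does jk) + 𝟙 (does jl))
                 + κ₂ n * (𝟙 (does ik) * 𝟙 (does jl) + 𝟙 (does il) * 𝟙 (does jk)))
    lengthProduct-moment i≢j k≢l (yes refl) (yes refl) _ _ = ⊥-elim (k≢l refl)
    lengthProduct-moment i≢j k≢l (yes refl) _ (yes refl) _ = ⊥-elim (i≢j refl)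
    lengthProduct-moment i≢j k≢l _ (yes refl) _ (yes refl) = ⊥-elim (i≢j refl)
    lengthProduct-moment i≢j k≢l _ _ (yes refl) (yes refl) = ⊥-elim (k≢l refl)
    lengthProduct-moment {i} {j} i≢j k≢l (yes refl) (no _) (no _) (yes refl) =
      via-pair {lengthProduct i j i j} (moment-pair² i≢j)
    lengthProduct-moment {i} {j} i≢j k≢l (no _) (yes refl) (yes refl) (no _) =
      via-pair {lengthProduct i j j i} (trans (cong (6 *_) (lengthProduct-swapʳ i j j i)) (moment-pair² i≢j))
    lengthProduct-moment {i} {j} {_} {l} i≢j k≢l (yes refl) (no i≢l) (no _) (no j≢l) =
      via-path {lengthProduct i j i l} (moment-path i≢j i≢l j≢l)
    lengthProduct-moment {i} {j} {k} i≢j k≢l (no i≢k) (yes refl) (no j≢k) (no _) =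
      via-path {lengthProduct i j k i} (trans (cong (60 *_) (lengthProduct-swapʳ i j k i)) (moment-path i≢j i≢k j≢k))
    lengthProduct-moment {i} {j} {_} {l} i≢j k≢l (no _) (no i≢l) (yes refl) (no j≢l) =
      via-path {lengthProduct i j j l} (trans (cong (60 *_) (lengthProduct-swapˡ i j j l)) (moment-path (≢-sym i≢j) j≢l i≢l))
    lengthProduct-moment {i} {j} {k} i≢j k≢l (no i≢k) (no _) (no j≢k) (yes refl) =
      via-path {lengthProduct i j k j} (trans (cong (60 *_) (trans (lengthProduct-swapˡ i j k j) (lengthProduct-swapʳ j i k j)))
                      (moment-path (≢-sym i≢j) j≢k i≢k))
    lengthProduct-moment {i} {j} {k} {l} i≢j k≢l (no i≢k) (no i≢l) (no j≢k) (no j≢l) =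
      via-matching {lengthProduct i j k l} (moment-matching i≢j i≢k i≢l j≢k j≢l k≢l)

  module _ {n : ℕ} (G : SimpleGraph n) where

    open SymmetricKernel (adjacency G) (adjacency-sym G)
      using (∑⁴-coincidences; ∑⁴-doubleCoincidences)
      renaming (weight to adjacencyProduct)

    ∑-arrangements-D : 3 * ∑ (arrangements n) (D G) ≡ numEdges G * (n ! * (n + 1))
    ∑-arrangements-D = *-cancelˡ-≡ _ _ 2 (begin
      2 * (3 * ∑ A (D G))                                ≡⟨ x∙yz≈y∙xz 2 3 (∑ A (D G)) ⟩
      3 * (2 * ∑ A (D G))                                ≡⟨ cong (3 *_) (∑-*ˡ A 2 (D G)) ⟨
      3 * ∑ A (λ π → 2 * D G π)                          ≡⟨ cong (3 *_) (∑-cong A (2*D G)) ⟩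
      3 * ∑ A (λ π → ∑² (λ i j → a i j * edgeLength π i j)) ≡⟨ cong (3 *_) (∑-∑²-comm {n = n} A (λ π i j → a i j * edgeLength π i j)) ⟩
      3 * ∑² (λ i j → ∑ A (λ π → a i j * edgeLength π i j)) ≡⟨ ∑²-*ˡ {n} 3 (λ i j → ∑ A (λ π → a i j * edgeLength π i j)) ⟨
      ∑² (λ i j → 3 * ∑ A (λ π → a i j * edgeLength π i j)) ≡⟨ ∑²-cong {n} edge-term ⟩
      ∑² (λ i j → (n ! * (n + 1)) * a i j)               ≡⟨ ∑²-*ˡ {n} (n ! * (n + 1)) (adjacency G) ⟩
      (n ! * (n + 1)) * ∑² (adjacency G)                 ≡⟨ cong ((n ! * (n + 1)) *_) (2*numEdges G) ⟨
      (n ! * (n + 1)) * (2 * numEdges G)                 ≡⟨ x∙yz≈y∙xz (n ! * (n + 1)) 2 (numEdges G) ⟩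
      2 * ((n ! * (n + 1)) * numEdges G)                 ≡⟨ cong (2 *_) (*-comm _ (numEdges G)) ⟩
      2 * (numEdges G * (n ! * (n + 1)))                 ∎)
      where
      A = arrangements n
      a = adjacency G
      edge-term : ∀ i j → 3 * ∑ A (λ π → a i j * edgeLength π i j) ≡ (n ! * (n + 1)) * a i j
      edge-term i j with adj G i j in aᵢⱼ
      ... | false = trans (cong (3 *_) (∑-zero A)) (sym (*-zeroʳ (n ! * (n + 1))))
      ... | true  = trans (cong (3 *_) (∑-cong A (λ π → +-identityʳ (edgeLength π i j))))
                          (trans (moment-pair (adj⇒≢ G aᵢⱼ)) (sym (*-identityʳ (n ! * (n + 1)))))

    private
      AA E Z P : Fin n → Fin n → Fin n → Fin n → ℕ
      AA = adjacencyProduct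
      E  = coincidences
      Z  = doubleCoincidences
      P  = lengthProduct

    ∑-arrangements-4D² : 4 * ∑ (arrangements n) (λ π → D G π * D G π) ≡ ∑⁴ (λ i j k l → AA i j k l * P i j k l)
    ∑-arrangements-4D² = begin
      4 * ∑ A (λ π → D G π * D G π)                  ≡⟨ ∑-*ˡ A 4 (λ π → D G π * D G π) ⟨
      ∑ A (λ π → 4 * (D G π * D G π))                ≡⟨ ∑-cong A (λ π → trans (square-twice (D G π)) (cong₂ _*_ (2*D G π) (2*D G π))) ⟩
      ∑ A (λ π → ∑² (ℓ π) * ∑² (ℓ π))                ≡⟨ ∑-cong A (λ π → ∑²-product (ℓ π) (ℓ π)) ⟩
      ∑ A (λ π → ∑⁴ (λ i j k l → ℓ π i j * ℓ π k l)) ≡⟨ ∑-∑⁴-comm A (λ π i j k l → ℓ π i j * ℓ π k l) ⟩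
      ∑⁴ (λ i j k l → ∑ A (λ π → ℓ π i j * ℓ π k l))
        ≡⟨ ∑⁴-cong (λ i j k l → trans (∑-cong A (λ π → interchange (adjacency G i j) (edgeLength π i j) (adjacency G k l) (edgeLength π k l)))
                                      (∑-*ˡ A (AA i j k l) (λ π → edgeLength π i j * edgeLength π k l))) ⟩
      ∑⁴ (λ i j k l → AA i j k l * P i j k l)       ∎
      where
      A = arrangements n
      ℓ : Vec (Fin n) n → Fin n → Fin n → ℕ
      ℓ π i j = adjacency G i j * edgeLength π i j
      square-twice : ∀ x → 4 * (x * x) ≡ (2 * x) * (2 * x)
      square-twice = solve-∀
      interchange : ∀ a x b y → (a * x) * (b * y) ≡ (a * b) * (x * y)
      interchange = solve-∀

    weighted-lengthProduct-moment : ∀ i j k l →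
      AA i j k l * (180 * P i j k l + n ! * (κ₀ n * E i j k l + 2 * κ₁ n * Z i j k l))
        ≡ AA i j k l * (n ! * (κ₀ n + κ₀ n * Z i j k l + κ₁ n * E i j k l + κ₂ n * Z i j k l))
    weighted-lengthProduct-moment i j k l with adj G i j in aᵢⱼ | adj G k l in aₖₗ
    ... | false | _     = refl
    ... | true  | false = refl
    ... | true  | true  =
      cong (1 *_) (lengthProduct-moment (adj⇒≢ G aᵢⱼ) (adj⇒≢ G aₖₗ) (i Fin.≟ k) (i Fin.≟ l) (j Fin.≟ k) (j Fin.≟ l))

    private
      N m s : ℕ
      N = n !
      m = numEdges G
      s = sumSqDeg G

      AAP EAA ZAA : Fin n → Fin n → Fin n → Fin n → ℕ
      AAP i j k l = AA i j k l * P i j k l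
      EAA i j k l = E i j k l * AA i j k l
      ZAA i j k l = Z i j k l * AA i j k l

    ∑⁴-adjacencyProduct : ∑⁴ AA ≡ (2 * m) * (2 * m)
    ∑⁴-adjacencyProduct = trans (sym (∑²-product (adjacency G) (adjacency G))) (cong (λ x → x * x) (sym (2*numEdges G)))

    ∑⁴-coincidences-adjacency : ∑⁴ EAA ≡ 4 * s
    ∑⁴-coincidences-adjacency = trans ∑⁴-coincidences (cong (4 *_) (sym (sumSqDeg≡ G)))

    ∑⁴-doubleCoincidences-adjacency : ∑⁴ ZAA ≡ 2 * (2 * m)
    ∑⁴-doubleCoincidences-adjacency =
      trans ∑⁴-doubleCoincidences (cong (2 *_) (trans (∑²-cong {n} (λ i j → 𝟙-idem (adj G i j))) (sym (2*numEdges G))))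
      where
      𝟙-idem : ∀ b → 𝟙 b * 𝟙 b ≡ 𝟙 b
      𝟙-idem true  = refl
      𝟙-idem false = refl

    ∑⁴-weighted-lengthProduct-moment :
      180 * ∑⁴ AAP + N * κ₀ n * ∑⁴ EAA + N * (2 * κ₁ n) * ∑⁴ ZAA
        ≡ N * κ₀ n * ∑⁴ AA + N * κ₁ n * ∑⁴ EAA + N * (κ₀ n + κ₂ n) * ∑⁴ ZAA
    ∑⁴-weighted-lengthProduct-moment = begin
      180 * ∑⁴ AAP + N * κ₀ n * ∑⁴ EAA + N * (2 * κ₁ n) * ∑⁴ ZAA
        ≡⟨ ∑⁴-linear₃ 180 (N * κ₀ n) (N * (2 * κ₁ n)) AAP EAA ZAA ⟨
      ∑⁴ (λ i j k l → 180 * AAP i j k l + N * κ₀ n * EAA i j k l + N * (2 * κ₁ n) * ZAA i j k l)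
        ≡⟨ ∑⁴-cong pointwise ⟩
      ∑⁴ (λ i j k l → N * κ₀ n * AA i j k l + N * κ₁ n * EAA i j k l + N * (κ₀ n + κ₂ n) * ZAA i j k l)
        ≡⟨ ∑⁴-linear₃ (N * κ₀ n) (N * κ₁ n) (N * (κ₀ n + κ₂ n)) AA EAA ZAA ⟩
      N * κ₀ n * ∑⁴ AA + N * κ₁ n * ∑⁴ EAA + N * (κ₀ n + κ₂ n) * ∑⁴ ZAA ∎
      where
      factorˡ : ∀ A P N k₀ k₁ E Z → 180 * (A * P) + N * k₀ * (E * A) + N * (2 * k₁) * (Z * A)
                                  ≡ A * (180 * P + N * (k₀ * E + 2 * k₁ * Z))
      factorˡ = solve-∀
      factorʳ : ∀ A N k₀ k₁ k₂ E Z → A * (N * (k₀ + k₀ * Z + k₁ * E + k₂ * Z))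
                                     ≡ N * k₀ * A + N * k₁ * (E * A) + N * (k₀ + k₂) * (Z * A)
      factorʳ = solve-∀
      pointwise : ∀ i j k l → 180 * AAP i j k l + N * κ₀ n * EAA i j k l + N * (2 * κ₁ n) * ZAA i j k l
                            ≡ N * κ₀ n * AA i j k l + N * κ₁ n * EAA i j k l + N * (κ₀ n + κ₂ n) * ZAA i j k l
      pointwise i j k l = trans (factorˡ (AA i j k l) (P i j k l) N (κ₀ n) (κ₁ n) (E i j k l) (Z i j k l))
                                (trans (weighted-lengthProduct-moment i j k l)
                                       (factorʳ (AA i j k l) N (κ₀ n) (κ₁ n) (κ₂ n) (E i j k l) (Z i j k l)))

    -- Both sides are moved so that no subtraction occurs.
    ∑-arrangements-D² :
      180 * ∑ (arrangements n) (λ π → D G π * D G π) + n ! * (κ₀ n * sumSqDeg G + 2 * κ₁ n * numEdges G)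
        ≡ n ! * (κ₀ n * (numEdges G * numEdges G) + κ₁ n * sumSqDeg G + (κ₀ n + κ₂ n) * numEdges G)
    ∑-arrangements-D² = *-cancelˡ-≡ _ _ 4 (begin
      4 * (180 * X + N * (κ₀ n * s + 2 * κ₁ n * m))
        ≡⟨ spread X N (κ₀ n) (κ₁ n) s m ⟩
      180 * (4 * X) + N * κ₀ n * (4 * s) + N * (2 * κ₁ n) * (2 * (2 * m))
        ≡⟨ cong₂ _+_ (cong₂ _+_ (cong (180 *_) (sym ∑-arrangements-4D²)) (cong (N * κ₀ n *_) ∑⁴-coincidences-adjacency))
                     (cong (N * (2 * κ₁ n) *_) ∑⁴-doubleCoincidences-adjacency) ⟨
      180 * ∑⁴ AAP + N * κ₀ n * ∑⁴ EAA + N * (2 * κ₁ n) * ∑⁴ ZAA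
        ≡⟨ ∑⁴-weighted-lengthProduct-moment ⟩
      N * κ₀ n * ∑⁴ AA + N * κ₁ n * ∑⁴ EAA + N * (κ₀ n + κ₂ n) * ∑⁴ ZAA
        ≡⟨ cong₂ _+_ (cong₂ _+_ (cong (N * κ₀ n *_) ∑⁴-adjacencyProduct) (cong (N * κ₁ n *_) ∑⁴-coincidences-adjacency))
                     (cong (N * (κ₀ n + κ₂ n) *_) ∑⁴-doubleCoincidences-adjacency) ⟩
      N * κ₀ n * ((2 * m) * (2 * m)) + N * κ₁ n * (4 * s) + N * (κ₀ n + κ₂ n) * (2 * (2 * m))
        ≡⟨ gather N (κ₀ n) (κ₁ n) (κ₂ n) s m ⟩
      4 * (N * (κ₀ n * (m * m) + κ₁ n * s + (κ₀ n + κ₂ n) * m)) ∎)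
      where
      X = ∑ (arrangements n) (λ π → D G π * D G π)
      spread : ∀ X N k₀ k₁ s m → 4 * (180 * X + N * (k₀ * s + 2 * k₁ * m))
                               ≡ 180 * (4 * X) + N * k₀ * (4 * s) + N * (2 * k₁) * (2 * (2 * m))
      spread = solve-∀
      gather : ∀ N k₀ k₁ k₂ s m → N * k₀ * ((2 * m) * (2 * m)) + N * k₁ * (4 * s) + N * (k₀ + k₂) * (2 * (2 * m))
                                ≡ 4 * (N * (k₀ * (m * m) + k₁ * s + (k₀ + k₂) * m))
      gather = solve-∀

module RationalCasts where

  open import Defs using (ℕtoℚ)
  open import Data.Nat as ℕ using (ℕ; suc)
  import Data.Nat.Properties as ℕ
  open import Data.Integer as ℤ using (+_)
  import Data.Integer.Properties as ℤ
  open import Data.Rational as ℚ using (ℚ; _/_; 1ℚ)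
  open import Data.Rational.Properties using (toℚᵘ-injective; toℚᵘ-fromℚᵘ; toℚᵘ-homo-+; toℚᵘ-homo-*)
  open import Data.Rational.Unnormalised as ℚᵘ using (mkℚᵘ; *≡*)
  open import Data.Rational.Unnormalised.Properties as ℚᵘ using (≃-trans; ≃-sym)
  open import Relation.Binary.PropositionalEquality

  toℚᵘ-/ : ∀ k d → ℚ.toℚᵘ ((+ k) / suc d) ℚᵘ.≃ mkℚᵘ (+ k) d
  toℚᵘ-/ k d = toℚᵘ-fromℚᵘ (mkℚᵘ (+ k) d)

  ℕtoℚ-+ : ∀ a b → ℕtoℚ (a ℕ.+ b) ≡ ℕtoℚ a ℚ.+ ℕtoℚ b
  ℕtoℚ-+ a b = toℚᵘ-injective (≃-trans (toℚᵘ-/ (a ℕ.+ b) 0) (≃-trans unnormalised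
    (≃-sym (≃-trans (toℚᵘ-homo-+ (ℕtoℚ a) (ℕtoℚ b)) (ℚᵘ.+-cong (toℚᵘ-/ a 0) (toℚᵘ-/ b 0))))))
    where
    unnormalised : mkℚᵘ (+ (a ℕ.+ b)) 0 ℚᵘ.≃ mkℚᵘ (+ a) 0 ℚᵘ.+ mkℚᵘ (+ b) 0
    unnormalised = *≡* (cong (ℤ._* + 1) (trans (ℤ.pos-+ a b)
      (sym (cong₂ ℤ._+_ (ℤ.*-identityʳ (+ a)) (ℤ.*-identityʳ (+ b))))))

  ℕtoℚ-* : ∀ a b → ℕtoℚ (a ℕ.* b) ≡ ℕtoℚ a ℚ.* ℕtoℚ b
  ℕtoℚ-* a b = toℚᵘ-injective (≃-trans (toℚᵘ-/ (a ℕ.* b) 0) (≃-trans unnormalised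
    (≃-sym (≃-trans (toℚᵘ-homo-* (ℕtoℚ a) (ℕtoℚ b)) (ℚᵘ.*-cong (toℚᵘ-/ a 0) (toℚᵘ-/ b 0))))))
    where
    unnormalised : mkℚᵘ (+ (a ℕ.* b)) 0 ℚᵘ.≃ mkℚᵘ (+ a) 0 ℚᵘ.* mkℚᵘ (+ b) 0
    unnormalised = *≡* (cong (ℤ._* + 1) (ℤ.pos-* a b))

  /-as-* : ∀ k d → (+ k) / suc d ≡ ℕtoℚ k ℚ.* ((+ 1) / suc d)
  /-as-* k d = toℚᵘ-injective (≃-trans (toℚᵘ-/ k d) (≃-trans unnormalised
    (≃-sym (≃-trans (toℚᵘ-homo-* (ℕtoℚ k) ((+ 1) / suc d)) (ℚᵘ.*-cong (toℚᵘ-/ k 0) (toℚᵘ-/ 1 d))))))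
    where
    unnormalised : mkℚᵘ (+ k) d ℚᵘ.≃ mkℚᵘ (+ k) 0 ℚᵘ.* mkℚᵘ (+ 1) d
    unnormalised = *≡* (cong₂ ℤ._*_ (sym (ℤ.*-identityʳ (+ k))) (cong +_ (ℕ.+-identityʳ (suc d))))

  ℕtoℚ-*-/ : ∀ l → ℕtoℚ (suc l) ℚ.* ((+ 1) / suc l) ≡ 1ℚ
  ℕtoℚ-*-/ l = trans (sym (/-as-* (suc l) l)) (toℚᵘ-injective (≃-trans (toℚᵘ-/ (suc l) l)
    (*≡* (trans (ℤ.*-identityʳ (+ suc l)) (sym (ℤ.*-identityˡ (+ suc l)))))))

  infixl 6 _⊕_
  infixl 7 _⊗_
  infix 8 ‵_

  data Expr : Set where
    ‵_  : ℕ → Expr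
    _⊕_ : Expr → Expr → Expr
    _⊗_ : Expr → Expr → Expr

  ⟦_⟧ℕ : Expr → ℕ
  ⟦ ‵ a ⟧ℕ   = a
  ⟦ e ⊕ f ⟧ℕ = ⟦ e ⟧ℕ ℕ.+ ⟦ f ⟧ℕ
  ⟦ e ⊗ f ⟧ℕ = ⟦ e ⟧ℕ ℕ.* ⟦ f ⟧ℕ

  ⟦_⟧ℚ : Expr → ℚ
  ⟦ ‵ a ⟧ℚ   = ℕtoℚ a
  ⟦ e ⊕ f ⟧ℚ = ⟦ e ⟧ℚ ℚ.+ ⟦ f ⟧ℚ
  ⟦ e ⊗ f ⟧ℚ = ⟦ e ⟧ℚ ℚ.* ⟦ f ⟧ℚ

  ℕtoℚ-⟦⟧ : ∀ e → ℕtoℚ ⟦ e ⟧ℕ ≡ ⟦ e ⟧ℚ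
  ℕtoℚ-⟦⟧ (‵ a)   = refl
  ℕtoℚ-⟦⟧ (e ⊕ f) = trans (ℕtoℚ-+ ⟦ e ⟧ℕ ⟦ f ⟧ℕ) (cong₂ ℚ._+_ (ℕtoℚ-⟦⟧ e) (ℕtoℚ-⟦⟧ f))
  ℕtoℚ-⟦⟧ (e ⊗ f) = trans (ℕtoℚ-* ⟦ e ⟧ℕ ⟦ f ⟧ℕ) (cong₂ ℚ._*_ (ℕtoℚ-⟦⟧ e) (ℕtoℚ-⟦⟧ f))

  cast : ∀ e f → ⟦ e ⟧ℕ ≡ ⟦ f ⟧ℕ → ⟦ e ⟧ℚ ≡ ⟦ f ⟧ℚ
  cast e f e≡f = trans (sym (ℕtoℚ-⟦⟧ e)) (trans (cong ℕtoℚ e≡f) (ℕtoℚ-⟦⟧ f))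

module Variance where

  open FiniteSums
  open InjectiveVectors
  open GraphMoments
  open RationalCasts
  open import Defs renaming (sym to adj-sym)
  open import Data.Nat as ℕ using (ℕ; suc; _!)
  import Data.Nat.Properties as ℕ
  open import Data.Integer using (+_)
  open import Data.Rational as ℚ using (ℚ; _/_; 1ℚ; 0ℚ)
  open import Data.Rational.Solver using (module +-*-Solver)
  open import Data.Fin using (Fin)
  open import Data.Vec using (Vec; [])
  open import Data.List as List using (List; []; _∷_; length)
  import Data.List.Properties as List
  open import Data.Product using (∃; _,_)
  open import Algebra.Properties.CommutativeSemigroup ℕ.*-commutativeSemigroup using (x∙yz≈y∙xz)
  open import Relation.Binary.PropositionalEquality
  open ≡-Reasoning
  open +-*-Solver using (solve; _:+_; _:*_; _:-_; _:=_; con)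

  #arrangements : ∀ n → length (arrangements n) ≡ n !
  #arrangements n = trans (sym (∑-one (arrangements n)))
                          (trans (∑-arrangements-restrict {n} [] refl (λ _ → 1)) (ℕ.*-identityʳ (n !)))

  mean-cast : ∀ {A : Set} (xs : List A) (g : A → ℕ) {l} → length xs ≡ suc l →
              mean (List.map (λ x → ℕtoℚ (g x)) xs) ≡ ℕtoℚ (∑ xs g) ℚ.* ((+ 1) / suc l)
  mean-cast (x ∷ xs) g refl =
    cong₂ (λ u v → u ℚ.* ((+ 1) / suc v)) (sum-cast (x ∷ xs)) (List.length-map (λ y → ℕtoℚ (g y)) xs)
    where
    sum-cast : ∀ ys → List.foldr ℚ._+_ 0ℚ (List.map (λ y → ℕtoℚ (g y)) ys) ≡ ℕtoℚ (∑ ys g)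
    sum-cast []       = refl
    sum-cast (y ∷ ys) = trans (cong (ℕtoℚ (g y) ℚ.+_) (sum-cast ys)) (sym (ℕtoℚ-+ (g y) (∑ ys g)))

  Erla-cast : ∀ {n l} (g : Vec (Fin n) n → ℕ) → n ! ≡ suc l →
              Erla (λ π → ℕtoℚ (g π)) ≡ ℕtoℚ (∑ (arrangements n) g) ℚ.* ((+ 1) / suc l)
  Erla-cast {n} g n!≡1+l = mean-cast (arrangements n) g (trans (#arrangements n) n!≡1+l)

  scaled-mean : ∀ {c c⁻¹ y N q R : ℚ} → c ℚ.* c⁻¹ ≡ 1ℚ → N ℚ.* q ≡ 1ℚ → c ℚ.* y ≡ N ℚ.* R →
                y ℚ.* q ≡ c⁻¹ ℚ.* R
  scaled-mean {c} {c⁻¹} {y} {N} {q} {R} cc⁻¹≡1 Nq≡1 cy≡NR = begin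
    y ℚ.* q                         ≡⟨ unitˡ (y ℚ.* q) ⟩
    1ℚ ℚ.* (y ℚ.* q)                ≡⟨ cong (ℚ._* (y ℚ.* q)) cc⁻¹≡1 ⟨
    c ℚ.* c⁻¹ ℚ.* (y ℚ.* q)         ≡⟨ regroup c c⁻¹ y q ⟩
    c⁻¹ ℚ.* (c ℚ.* y) ℚ.* q         ≡⟨ cong (λ x → c⁻¹ ℚ.* x ℚ.* q) cy≡NR ⟩
    c⁻¹ ℚ.* (N ℚ.* R) ℚ.* q         ≡⟨ regroup′ c⁻¹ N R q ⟩
    c⁻¹ ℚ.* R ℚ.* (N ℚ.* q)         ≡⟨ cong (c⁻¹ ℚ.* R ℚ.*_) Nq≡1 ⟩
    c⁻¹ ℚ.* R ℚ.* 1ℚ                ≡⟨ unitʳ (c⁻¹ ℚ.* R) ⟩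
    c⁻¹ ℚ.* R                       ∎
    where
    unitˡ : ∀ x → x ≡ 1ℚ ℚ.* x
    unitˡ = solve 1 (λ x → x := con 1ℚ :* x) refl
    unitʳ : ∀ x → x ℚ.* 1ℚ ≡ x
    unitʳ = solve 1 (λ x → x :* con 1ℚ := x) refl
    regroup : ∀ c c⁻¹ y q → c ℚ.* c⁻¹ ℚ.* (y ℚ.* q) ≡ c⁻¹ ℚ.* (c ℚ.* y) ℚ.* q
    regroup = solve 4 (λ c c⁻¹ y q → c :* c⁻¹ :* (y :* q) := c⁻¹ :* (c :* y) :* q) refl
    regroup′ : ∀ c⁻¹ N R q → c⁻¹ ℚ.* (N ℚ.* R) ℚ.* q ≡ c⁻¹ ℚ.* R ℚ.* (N ℚ.* q)
    regroup′ = solve 4 (λ c⁻¹ N R q → c⁻¹ :* (N :* R) :* q := c⁻¹ :* R :* (N :* q)) refl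

  x+N*L≡N*R⇒x≡N*[R-L] : ∀ {x N L R : ℚ} → x ℚ.+ N ℚ.* L ≡ N ℚ.* R → x ≡ N ℚ.* (R ℚ.- L)
  x+N*L≡N*R⇒x≡N*[R-L] {x} {N} {L} {R} eq = begin
    x                               ≡⟨ cancel x N L ⟩
    x ℚ.+ N ℚ.* L ℚ.- N ℚ.* L       ≡⟨ cong (ℚ._- N ℚ.* L) eq ⟩
    N ℚ.* R ℚ.- N ℚ.* L             ≡⟨ factor N R L ⟩
    N ℚ.* (R ℚ.- L)                 ∎
    where
    cancel : ∀ x N L → x ≡ x ℚ.+ N ℚ.* L ℚ.- N ℚ.* L
    cancel = solve 3 (λ x N L → x := x :+ N :* L :- N :* L) refl
    factor : ∀ N R L → N ℚ.* R ℚ.- N ℚ.* L ≡ N ℚ.* (R ℚ.- L)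
    factor = solve 3 (λ N R L → N :* R :- N :* L := N :* (R :- L)) refl

  n!≡suc : ∀ n → ∃ λ l → n ! ≡ suc l
  n!≡suc n with l , 1+l≡n! ← ℕ.m≤n⇒∃[o]m+o≡n (ℕ.1≤n! n) = l , sym 1+l≡n!

  K₀ K₁ K₂ : ℕ → Expr
  K₀ n = ‵ 4 ⊗ ((‵ n ⊕ ‵ 1) ⊗ (‵ 5 ⊗ ‵ n ⊕ ‵ 4))
  K₁ n = ‵ 3 ⊗ ((‵ n ⊕ ‵ 1) ⊗ (‵ 7 ⊗ ‵ n ⊕ ‵ 4))
  K₂ n = ‵ 30 ⊗ (‵ n ⊗ (‵ n ⊕ ‵ 1))

  module _ {n : ℕ} (G : SimpleGraph n) where

    private
      m s : ℕ
      m = numEdges G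
      s = sumSqDeg G

    -- Matching on n!≡suc n by `with` would normalise the goals, rational constants included.
    expectation-D : Erla (λ π → ℕtoℚ (D G π)) ≡ ((+ 1) / 3) ℚ.* (ℕtoℚ m ℚ.* (ℕtoℚ n ℚ.+ ℕtoℚ 1))
    expectation-D = uniformly (n!≡suc n)
      where
      ΣD = ∑ (arrangements n) (D G)
      uniformly : (∃ λ l → n ! ≡ suc l) → Erla (λ π → ℕtoℚ (D G π)) ≡ ((+ 1) / 3) ℚ.* (ℕtoℚ m ℚ.* (ℕtoℚ n ℚ.+ ℕtoℚ 1))
      uniformly (l , n!≡1+l) =
        trans (Erla-cast (D G) n!≡1+l)
              (scaled-mean {ℕtoℚ 3} {(+ 1) / 3} {ℕtoℚ ΣD} {ℕtoℚ (n !)} {(+ 1) / suc l} {ℕtoℚ m ℚ.* (ℕtoℚ n ℚ.+ ℕtoℚ 1)}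
                           (ℕtoℚ-*-/ 2) (trans (cong (λ N → ℕtoℚ N ℚ.* ((+ 1) / suc l)) n!≡1+l) (ℕtoℚ-*-/ l))
                           (cast (‵ 3 ⊗ ‵ ΣD) (‵ (n !) ⊗ (‵ m ⊗ (‵ n ⊕ ‵ 1)))
                                 (trans (∑-arrangements-D G) (x∙yz≈y∙xz m (n !) (n ℕ.+ 1)))))

    private
      L₂ R₂ : Expr
      L₂ = K₀ n ⊗ ‵ s ⊕ ‵ 2 ⊗ K₁ n ⊗ ‵ m
      R₂ = K₀ n ⊗ (‵ m ⊗ ‵ m) ⊕ K₁ n ⊗ ‵ s ⊕ (K₀ n ⊕ K₂ n) ⊗ ‵ m

    expectation-D² : Erla (λ π → ℕtoℚ (D G π) ℚ.* ℕtoℚ (D G π)) ≡ ((+ 1) / 180) ℚ.* (⟦ R₂ ⟧ℚ ℚ.- ⟦ L₂ ⟧ℚ)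
    expectation-D² = uniformly (n!≡suc n)
      where
      ΣD² = ∑ (arrangements n) (λ π → D G π ℕ.* D G π)
      uniformly : (∃ λ l → n ! ≡ suc l) → Erla (λ π → ℕtoℚ (D G π) ℚ.* ℕtoℚ (D G π)) ≡ ((+ 1) / 180) ℚ.* (⟦ R₂ ⟧ℚ ℚ.- ⟦ L₂ ⟧ℚ)
      uniformly (l , n!≡1+l) =
        trans (cong mean (List.map-cong (λ π → sym (ℕtoℚ-* (D G π) (D G π))) (arrangements n)))
              (trans (Erla-cast (λ π → D G π ℕ.* D G π) n!≡1+l)
                     (scaled-mean {ℕtoℚ 180} {(+ 1) / 180} {ℕtoℚ ΣD²} {ℕtoℚ (n !)} {(+ 1) / suc l} {⟦ R₂ ⟧ℚ ℚ.- ⟦ L₂ ⟧ℚ}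
                                  (ℕtoℚ-*-/ 179)
                                  (trans (cong (λ N → ℕtoℚ N ℚ.* ((+ 1) / suc l)) n!≡1+l) (ℕtoℚ-*-/ l))
                                  (x+N*L≡N*R⇒x≡N*[R-L] {N = ℕtoℚ (n !)} {⟦ L₂ ⟧ℚ} {⟦ R₂ ⟧ℚ}
                                    (cast (‵ 180 ⊗ ‵ ΣD² ⊕ ‵ (n !) ⊗ L₂) (‵ (n !) ⊗ R₂) (∑-arrangements-D² G)))))

  variance-identity : ∀ m s k →
    let κ₀ = ℕtoℚ 4 ℚ.* ((k ℚ.+ ℕtoℚ 1) ℚ.* (ℕtoℚ 5 ℚ.* k ℚ.+ ℕtoℚ 4))
        κ₁ = ℕtoℚ 3 ℚ.* ((k ℚ.+ ℕtoℚ 1) ℚ.* (ℕtoℚ 7 ℚ.* k ℚ.+ ℕtoℚ 4))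
        κ₂ = ℕtoℚ 30 ℚ.* (k ℚ.* (k ℚ.+ ℕtoℚ 1))
        μ  = ((+ 1) / 3) ℚ.* (m ℚ.* (k ℚ.+ ℕtoℚ 1))
    in ((+ 1) / 180) ℚ.* ((κ₀ ℚ.* (m ℚ.* m) ℚ.+ κ₁ ℚ.* s ℚ.+ (κ₀ ℚ.+ κ₂) ℚ.* m) ℚ.- (κ₀ ℚ.* s ℚ.+ ℕtoℚ 2 ℚ.* κ₁ ℚ.* m))
         ℚ.- μ ℚ.* μ
       ≡ (k ℚ.+ ℕtoℚ 1) ℚ.* ((+ 1) / 45) ℚ.* (m ℚ.* (ℕtoℚ 2 ℚ.* (k ℚ.- ℕtoℚ 1) ℚ.- m) ℚ.+ (k ℚ.* ((+ 1) / 4) ℚ.- ℕtoℚ 1) ℚ.* s)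
  variance-identity = solve 3 (λ m s k →
    let κ₀ = con (ℕtoℚ 4) :* ((k :+ con (ℕtoℚ 1)) :* (con (ℕtoℚ 5) :* k :+ con (ℕtoℚ 4)))
        κ₁ = con (ℕtoℚ 3) :* ((k :+ con (ℕtoℚ 1)) :* (con (ℕtoℚ 7) :* k :+ con (ℕtoℚ 4)))
        κ₂ = con (ℕtoℚ 30) :* (k :* (k :+ con (ℕtoℚ 1)))
        μ  = con ((+ 1) / 3) :* (m :* (k :+ con (ℕtoℚ 1)))
    in con ((+ 1) / 180) :* ((κ₀ :* (m :* m) :+ κ₁ :* s :+ (κ₀ :+ κ₂) :* m) :- (κ₀ :* s :+ con (ℕtoℚ 2) :* κ₁ :* m))
         :- μ :* μ
       := (k :+ con (ℕtoℚ 1)) :* con ((+ 1) / 45) :* (m :* (con (ℕtoℚ 2) :* (k :- con (ℕtoℚ 1)) :- m)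
                                                    :+ (k :* con ((+ 1) / 4) :- con (ℕtoℚ 1)) :* s)) refl

open Variance
open RationalCasts using (/-as-*; ℕtoℚ-+)

open import Defs
open import Data.Nat using (ℕ)
open import Data.Integer using (+_)
open import Data.Rational using (_/_; _+_; _-_; _*_)
open import Relation.Binary.PropositionalEquality using (_≡_; cong; cong₂; trans; module ≡-Reasoning)
open ≡-Reasoning

mainTheorem6 : (n : ℕ) (G : SimpleGraph n) →
    Vrla-D G ≡
    ((+ (n Data.Nat.+ 1)) / 45) *
    ((ℕtoℚ (numEdges G) * ((ℕtoℚ 2 * (ℕtoℚ n - ℕtoℚ 1)) - ℕtoℚ (numEdges G)))
    + (((+ n) / 4 - ℕtoℚ 1) * ℕtoℚ (sumSqDeg G)))
mainTheorem6 n G = begin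
  Vrla-D G
    ≡⟨ cong₂ (λ u v → u - v * v) (expectation-D² G) (expectation-D G) ⟩
  _ ≡⟨ variance-identity m s k ⟩
  (k + ℕtoℚ 1) * ((+ 1) / 45) * (m * (ℕtoℚ 2 * (k - ℕtoℚ 1) - m) + (k * ((+ 1) / 4) - ℕtoℚ 1) * s)
    ≡⟨ cong₂ (λ u v → u * (m * (ℕtoℚ 2 * (k - ℕtoℚ 1) - m) + (v - ℕtoℚ 1) * s))
             (trans (/-as-* (n Data.Nat.+ 1) 44) (cong (_* ((+ 1) / 45)) (ℕtoℚ-+ n 1))) (/-as-* n 3) ⟨
  ((+ (n Data.Nat.+ 1)) / 45) * (m * (ℕtoℚ 2 * (k - ℕtoℚ 1) - m) + ((+ n) / 4 - ℕtoℚ 1) * s) ∎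
  where
  m = ℕtoℚ (numEdges G)
  s = ℕtoℚ (sumSqDeg G)
  k = ℕtoℚ n
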